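{- Let $\Gamma$ be a method specification, $\mathcal{L}_1,\mathcal{L}_2$ libraries and $I_1,I_2\subseteq\Sigma$. If $\mathcal{L}_1:\Gamma$ and $\mathcal{L}_2:\Gamma$ are safe for $I_1$ and $I_2$ respectively, then $(\mathcal{L}_1:\Gamma,I_1)\sqsubseteq(\mathcal{L}_2:\Gamma,I_2)$ holds if and only if for every $(l,H)\in\mathsf{interf}(\mathcal{L}_1:\Gamma,I_1)$ there exists $l'$ with $l'\preceq l$ and $(l',H)\in\mathsf{interf}(\mathcal{L}_2:\Gamma,I_2)$.
   Context: Separation algebra: a set $\Sigma$ with a partial commutative, associative (both sides defined and equal or both undefined), cancellative binary operation $*$ with unit $e$; $(\sigma_1*\sigma_2)\downarrow$ means defined; $\sigma_2\setminus\sigma_1$ is the unique $\sigma$ with $\sigma_2=\sigma*\sigma_1$. Footprint $\delta(\sigma)=\{\sigma'\mid\forall\sigma''.(\sigma'*\sigma'')\downarrow\iff(\sigma*\sigma'')\downarrow\}$; $\delta(\sigma_1)\circ\delta(\sigma_2)=\delta(\sigma_1*\sigma_2)$ if defined. Standing assumption: $*$ is cancellative on footprints (if $\sigma_1*\sigma_2,\sigma_1'*\sigma_2'$ defined, $\delta(\sigma_1*\sigma_2)=\delta(\sigma_1'*\sigma_2')$ and $\delta(\sigma_1)=\delta(\sigma_1')$ imply $\delta(\sigma_2)=\delta(\sigma_2')$). $l_2\mathbin{\backslash\!\backslash}l_1=\delta(\sigma)$ if $l_1=\delta(\sigma_1),l_2=\delta(\sigma_2),\sigma_2=\sigma_1*\sigma$;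 $l_1\preceq l_2$ iff $l_2\mathbin{\backslash\!\backslash}l_1$ defined. Histories: finite sequences of interface actions $(t,\mathsf{call}\,m(\sigma))$, $(t,\mathsf{ret}\,m(\sigma))$ (per thread alternating calls/returns of matching methods starting with a call). Balanced from $l$: the map $[\![\varepsilon]\!]^\sharp l=l$, $[\![H\psi]\!]^\sharp l=([\![H]\!]^\sharp l)\circ\delta(\sigma)$ (call carrying $\sigma$), $([\![H]\!]^\sharp l)\mathbin{\backslash\!\backslash}\delta(\sigma)$ (return carrying $\sigma$) is defined. $H\sqsubseteq H'$ iff there is a bijection $\rho$ of positions with $H(i)=H'(\rho(i))$ and, for $i<j$ with $H(i),H(j)$ by the same thread or $H(i)$ a return and $H(j)$ a call, $\rho(i)<\rho(j)$. $(l,H)\sqsubseteq(l',H')$ iff $l'\preceq l$ and $H\sqsubseteq H'$; for sets, $\mathcal{H}_1\sqsubseteq\mathcal{H}_2$ iff each element of $\mathcal{H}_1$ is $\sqsubseteq$ some element of $\mathcal{H}_2$. Primitive commands $c$ have transformers $f^t_c:\Sigma\to\mathcal{P}(\Sigma)\cup\{\top\}$ satisfying Footprint Preservation and Strong Locality ($\sigma'\in f^t_c(\sigma)\Rightarrow\delta(\sigma')=\delta(\sigma)$; $(\sigma_1*\sigma_2)\downarrow$, $f^t_c(\sigma_1)\ne\top$ imply $f^t_c(\sigma_1*\sigma_2)=\{\sigma'*\sigma_2\mid\sigma'\in f^t_c(\sigma_1)\}$). Libraries $\mathcal{L}=\{m=C_m\mid m\in M\}$, bodies $C::=c\mid C;C\mid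 C+C\mid C^*$. Precise predicate $r$: each $\sigma$ has at most one $\sigma_1\in r$ with $\sigma=\sigma_1*\sigma_2$; $\sigma\setminus r=\sigma_2$. Method specification: triples $\{p\}m\{q\}$ (at most one per method), $p,q$ maps from threads to precise predicates. Library-local semantics $[\![\mathcal{L}:\Gamma]\!]\sigma$: trace set = prefix closure of all interleavings (any number $k\ge1$ of threads) of threads each finitely often calling a method $m$, executing a trace of $(t,c)$ actions generated by $C_m$, and returning. Evaluation: $(t,c)$: $\top$ if $f^t_c(\sigma)=\top$, else $\{(\sigma',(t,c))\mid\sigma'\in f^t_c(\sigma)\}$; for $\{p\}m\{q\}\in\Gamma$, $(t,\mathsf{call}\,m)$ gives $\{(\sigma*\sigma_p,(t,\mathsf{call}\,m(\sigma_p)))\mid\sigma_p\in p_t,(\sigma*\sigma_p)\downarrow\}$; $(t,\mathsf{ret}\,m)$ gives $\top$ if $\sigma\setminus q_t$ undefined, else $\{(\sigma\setminus q_t,(t,\mathsf{ret}\,m(\sigma_q)))\}$, $\sigma_q\in q_t$ unique. Traces evaluated step by step ($\top$ propagates). $[\![\mathcal{L}:\Gamma]\!]\sigma=\top$ if some trace evaluates to $\top$, else the set of resulting annotated traces. Safe for $I$: $\ne\top$ for all $\sigma\in I$. $\mathsf{interf}(\mathcal{L}:\Gamma,I)=\{(\delta(\sigma_0),\mathsf{history}(\lambda))\mid\sigma_0\in I,\lambda\in[\![\mathcal{L}:\Gamma]\!]\sigma_0\}$ ($\mathsf{history}$ = subsequence of call/return actions), and $(\mathcal{L}_1:\Gamma,I_1)\sqsubseteq(\mathcal{L}_2:\Gamma,I_2)$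 iff $\mathsf{interf}(\mathcal{L}_1:\Gamma,I_1)\sqsubseteq\mathsf{interf}(\mathcal{L}_2:\Gamma,I_2)$. -}

module Defs where

open import Data.Nat using (ℕ; suc; _≥_)
open import Data.Fin using (Fin) renaming (_<_ to _<ᶠ_)
open import Data.Maybe using (Maybe; just; _>>=_)
open import Data.List using (List; []; _∷_; _++_; map; length; lookup)
open import Data.List.Relation.Ternary.Interleaving.Propositional using (Interleaving)
open import Data.Product using (Σ; ∃; _×_; _,_)
open import Data.Sum using (_⊎_)
open import Data.Empty using (⊥)
open import Data.Unit using (⊤)
open import Relation.Nullary using (¬_)
open import Relation.Binary.PropositionalEquality using (_≡_)
open import Function.Bundles using (_⤖_; _⇔_; Bijection)

record SepAlg : Set₁ where
  infixl 6 _⊛_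
  field
    St     : Set
    _⊛_    : St → St → Maybe St
    e      : St
    comm   : ∀ a b → a ⊛ b ≡ b ⊛ a
    -- both sides defined and equal, or both undefined
    assoc  : ∀ a b c → (a ⊛ b >>= λ ab → ab ⊛ c) ≡ (b ⊛ c >>= λ bc → a ⊛ bc)
    unit   : ∀ a → e ⊛ a ≡ just a
    cancel : ∀ a a' b c → a ⊛ b ≡ just c → a' ⊛ b ≡ just c → a ≡ a'

module _ (SA : SepAlg) where
  open SepAlg SA

  Defined : St → St → Set
  Defined a b = ∃ λ c → a ⊛ b ≡ just c

  -- Footprints are represented by a state σ (standing for δ(σ));
  -- σ' ∈ δ(σ)  iff  σ' ≈δ σ, and δ(σ) = δ(σ')  iff  σ ≈δ σ'.
  _≈δ_ : St → St → Set
  a ≈δ b = ∀ c → (Defined a c → Defined b c) × (Defined b c → Defined a c)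

  -- l₁ ⪯ l₂  iff  l₂ \\ l₁ defined, i.e. there are σ₁ ∈ l₁, σ₂ ∈ l₂, σ
  -- with σ₂ = σ₁ * σ
  _⪯_ : St → St → Set
  l₁ ⪯ l₂ = ∃ λ σ₁ → ∃ λ σ₂ → ∃ λ σ → σ₁ ≈δ l₁ × σ₂ ≈δ l₂ × σ₁ ⊛ σ ≡ just σ₂

  FootprintCancellative : Set
  FootprintCancellative =
    ∀ s₁ s₂ s s₁' s₂' s' → s₁ ⊛ s₂ ≡ just s → s₁' ⊛ s₂' ≡ just s' →
    s ≈δ s' → s₁ ≈δ s₁' → s₂ ≈δ s₂'

  Precise : (St → Set) → Set
  Precise r = ∀ σ a b a' b' → r a → r a' → a ⊛ b ≡ just σ → a' ⊛ b' ≡ just σ → a ≡ a'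

Tid : Set
Tid = ℕ

-- P(Σ) ∪ {⊤}
data Outcome (A : Set) : Set₁ where
  fault : Outcome A
  ok    : (A → Set) → Outcome A

_∈O_ : ∀ {A} → A → Outcome A → Set
a ∈O fault = ⊥
a ∈O ok Q  = Q a

IsFault : ∀ {A} → Outcome A → Set
IsFault fault  = ⊤
IsFault (ok _) = ⊥

record Prims (SA : SepAlg) : Set₁ where
  open SepAlg SA
  field
    Cmd : Set
    f   : Tid → Cmd → St → Outcome St
    footprint-preservation :
      ∀ t c σ P σ' → f t c σ ≡ ok P → P σ' → _≈δ_ SA σ' σ
    strong-locality :
      ∀ t c σ₁ σ₂ σ P → σ₁ ⊛ σ₂ ≡ just σ → f t c σ₁ ≡ ok P →
      Σ (St → Set) λ Q → f t c σ ≡ ok Q ×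
        (∀ σ' → Q σ' ⇔ (∃ λ σ₁' → P σ₁' × σ₁' ⊛ σ₂ ≡ just σ'))

data Com (C : Set) : Set where
  prim : C → Com C
  _⨾_  : Com C → Com C → Com C
  _⊕_  : Com C → Com C → Com C
  _⋆   : Com C → Com C

data Gen {C : Set} : Com C → List C → Set where
  g-prim : ∀ c → Gen (prim c) (c ∷ [])
  g-seq  : ∀ {C₁ C₂ τ₁ τ₂} → Gen C₁ τ₁ → Gen C₂ τ₂ → Gen (C₁ ⨾ C₂) (τ₁ ++ τ₂)
  g-inl  : ∀ {C₁ C₂ τ} → Gen C₁ τ → Gen (C₁ ⊕ C₂) τ
  g-inr  : ∀ {C₁ C₂ τ} → Gen C₂ τ → Gen (C₁ ⊕ C₂) τ
  g-nil  : ∀ {C₁} → Gen (C₁ ⋆) []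
  g-more : ∀ {C₁ τ₁ τ₂} → Gen C₁ τ₁ → Gen (C₁ ⋆) τ₂ → Gen (C₁ ⋆) (τ₁ ++ τ₂)

Library : Set → Set → Set
Library C M = M → Com C

record Spec (SA : SepAlg) (M : Set) : Set₁ where
  open SepAlg SA
  field
    pre  : M → Tid → St → Set
    post : M → Tid → St → Set
    pre-precise  : ∀ m t → Precise SA (pre m t)
    post-precise : ∀ m t → Precise SA (post m t)

data IAct (S M : Set) : Set where
  call : Tid → M → S → IAct S M
  ret  : Tid → M → S → IAct S M

IThread : ∀ {S M} → IAct S M → Tid
IThread (call t _ _) = t
IThread (ret t _ _)  = t

IsCall IsRet : ∀ {S M} → IAct S M → Set
IsCall a = ∃ λ t → ∃ λ m → ∃ λ s → a ≡ call t m s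
IsRet  a = ∃ λ t → ∃ λ m → ∃ λ s → a ≡ ret t m s

History : Set → Set → Set
History S M = List (IAct S M)

_⊑H_ : ∀ {S M} → History S M → History S M → Set
H ⊑H H' = Σ (Fin (length H) ⤖ Fin (length H')) λ ρ →
  let open Bijection ρ renaming (to to ρf) in
  (∀ i → lookup H i ≡ lookup H' (ρf i)) ×
  (∀ i j → i <ᶠ j →
     (IThread (lookup H i) ≡ IThread (lookup H j)) ⊎ (IsRet (lookup H i) × IsCall (lookup H j)) →
     ρf i <ᶠ ρf j)

module Sem (SA : SepAlg) (P : Prims SA) {M : Set} (Γ : Spec SA M) where
  open SepAlg SA
  open Prims P
  open Spec Γ

  data Act : Set where
    callA : Tid → M → Act
    retA  : Tid → M → Act
    cmdA  : Tid → Cmd → Act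

  data AAct : Set where
    iact  : IAct St M → AAct
    cmdI  : Tid → Cmd → AAct

  history : List AAct → History St M
  history []              = []
  history (iact a ∷ α)    = a ∷ history α
  history (cmdI _ _ ∷ α)  = history α

  module _ (L : Library Cmd M) where

    data ThreadTr (t : Tid) : List Act → Set where
      done   : ThreadTr t []
      invoke : ∀ m τ rest → Gen (L m) τ → ThreadTr t rest →
               ThreadTr t (callA t m ∷ (map (cmdA t) τ ++ (retA t m ∷ rest)))

    AllThreads : ℕ → List Act → Set
    AllThreads ℕ.zero    τ = τ ≡ []
    AllThreads (suc k) τ = ∃ λ τ₁ → ∃ λ τ₂ →
      ThreadTr (suc k) τ₁ × AllThreads k τ₂ × Interleaving τ₁ τ₂ τ

    Trace : List Act → Set
    Trace τ = ∃ λ k → k ≥ 1 × ∃ λ τ' → AllThreads k (τ ++ τ')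

  data Step : St → Act → St → AAct → Set where
    s-cmd  : ∀ {t c σ σ'} → σ' ∈O f t c σ →
             Step σ (cmdA t c) σ' (cmdI t c)
    s-call : ∀ {t m σ σp σ'} → pre m t σp → σ ⊛ σp ≡ just σ' →
             Step σ (callA t m) σ' (iact (call t m σp))
    -- σ' = σ \ q_t, σq ∈ q_t the unique splitting component
    s-ret  : ∀ {t m σ σq σ'} → post m t σq → σq ⊛ σ' ≡ just σ →
             Step σ (retA t m) σ' (iact (ret t m σq))

  data StepFault : St → Act → Set where
    f-cmd : ∀ {t c σ} → IsFault (f t c σ) → StepFault σ (cmdA t c)
    f-ret : ∀ {t m σ} → ¬ (∃ λ σq → ∃ λ σ' → post m t σq × σq ⊛ σ' ≡ just σ) →
            StepFault σ (retA t m)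

  data Run : St → List Act → St → List AAct → Set where
    r-nil  : ∀ {σ} → Run σ [] σ []
    r-cons : ∀ {σ a τ σ₁ b σ₂ α} → Step σ a σ₁ b → Run σ₁ τ σ₂ α →
             Run σ (a ∷ τ) σ₂ (b ∷ α)

  data RunFault : St → List Act → Set where
    rf-here  : ∀ {σ a τ} → StepFault σ a → RunFault σ (a ∷ τ)
    rf-later : ∀ {σ a τ σ₁ b} → Step σ a σ₁ b → RunFault σ₁ τ → RunFault σ (a ∷ τ)

  Safe : Library Cmd M → (St → Set) → Set
  Safe L I = ∀ σ → I σ → ∀ τ → Trace L τ → ¬ RunFault σ τ

  -- (l , H) ∈ interf(L : Γ, I), with the footprint l given by a representative
  interf : Library Cmd M → (St → Set) → St → History St M → Set
  interf L I l H = ∃ λ σ₀ → I σ₀ × _≈δ_ SA l σ₀ ×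
    ∃ λ τ → Trace L τ × ∃ λ σ' → ∃ λ α → Run σ₀ τ σ' α × history α ≡ H

  _⊑LH_ : St × History St M → St × History St M → Set
  (l , H) ⊑LH (l' , H') = _⪯_ SA l' l × H ⊑H H'

  LibLe : Library Cmd M → (St → Set) → Library Cmd M → (St → Set) → Set
  LibLe L₁ I₁ L₂ I₂ = ∀ l H → interf L₁ I₁ l H →
    ∃ λ l' → ∃ λ H' → interf L₂ I₂ l' H' × (l , H) ⊑LH (l' , H')

-- Only ⇒ needs an argument (⇐ takes H' = H).  Given (l, H) from L₁ and
-- (l', H') from L₂ with l' ⪯ l and H ⊑ H', the run of L₂ producing H' is
-- rearranged, event by event of H, into a run producing H: a call of H that the
-- original run makes later is performed early ("hoisted"), a return that it
-- makes earlier is deferred, and all other actions are replayed in order.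
-- The resources of hoisted calls and deferred returns are carried as a frame,
-- so by strong locality every command still runs, and deferred returns find
-- their resource.  A call can be hoisted because the state's footprint stays
-- below the one reached along H from l, and H is balanced from l since L₁
-- produces it.  Every reordering swaps adjacent actions of different threads,
-- so the new trace is still generated by L₂.
module Submission where

open import Defs
open import Data.Product using (∃; _×_)
open import Function.Bundles using (_⇔_)

open import Algebra.Bundles using (CommutativeMonoid)
open import Algebra.Structures.Biased using (isCommutativeMonoidˡ)
open import Data.Bool using (Bool; true; false)
open import Data.Bool.Properties using (not-¬)
open import Data.Empty using (⊥; ⊥-elim)
open import Data.Fin using (Fin; toℕ; fromℕ<; zero; suc)
open import Data.Fin.Properties using (toℕ-injective; toℕ<n; fromℕ<-toℕ; toℕ-fromℕ<; fromℕ<-cong)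
open import Data.List using (List; []; _∷_; _++_; map; length; lookup; take; drop)
open import Data.List.Properties using (++-assoc; map-++; ++-identityʳ; ∷-injectiveˡ; ∷-injectiveʳ)
open import Data.List.Relation.Ternary.Interleaving using ([])
open import Data.List.Relation.Ternary.Interleaving.Propositional using (Interleaving; consˡ; consʳ)
open import Data.List.Relation.Unary.All as All using (All; []; _∷_)
open import Data.List.Relation.Unary.All.Properties as All using ()
open import Data.List.Relation.Unary.Any using (Any; here; there)
open import Data.List.Relation.Unary.Any.Properties as Any using ()
open import Data.Maybe using (Maybe; just; nothing; _>>=_)
open import Data.Nat using (ℕ; zero; suc; pred; _+_; _≤_; _<_; z≤n; s≤s)
open import Data.Nat.Properties
  using (<-irrefl; <-asym; _<?_; _≟_; ≤-reflexive; ≤-refl; ≤-pred; +-suc; m≤n⇒m≤1+n)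
open import Data.Product as Product using (Σ; _,_; proj₁; proj₂; ∃₂; swap)
open import Data.Sum as Sum using (_⊎_; inj₁; inj₂)
open import Data.Unit using (⊤; tt)
open import Function using (id; _∘_)
open import Function.Bundles using (Bijection; Equivalence; mk⇔)
open import Function.Construct.Identity using (⤖-id)
open import Relation.Binary.Construct.Closure.ReflexiveTransitive as Star using (Star; ε; _◅_; _◅◅_)
open import Relation.Binary.PropositionalEquality
  using (_≡_; _≢_; refl; sym; trans; cong; cong₂; subst; subst₂; isEquivalence; module ≡-Reasoning)
open import Relation.Nullary using (¬_; Dec; yes; no)
open ≡-Reasoning

module Footprint (SA : SepAlg) where
  open SepAlg SA

  infix 4 _≈_ _≼_
  _≈_ _≼_ : St → St → Set
  _≈_ = _≈δ_ SA
  _≼_ = _⪯_ SA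

  ≈-refl : ∀ {a} → a ≈ a
  ≈-refl c = id , id

  ≈-sym : ∀ {a b} → a ≈ b → b ≈ a
  ≈-sym a≈b c = swap (a≈b c)

  ≈-trans : ∀ {a b d} → a ≈ b → b ≈ d → a ≈ d
  ≈-trans a≈b b≈d c = proj₁ (b≈d c) ∘ proj₁ (a≈b c) , proj₂ (a≈b c) ∘ proj₂ (b≈d c)

  ≈⇒defined : ∀ {a b c} → a ≈ b → Defined SA a c → Defined SA b c
  ≈⇒defined a≈b = proj₁ (a≈b _)

  -- The partial product lifted to Maybe St, with nothing absorbing, so that
  -- iterated products can be reassociated freely.
  infixl 6 _⊙_
  _⊙_ : Maybe St → Maybe St → Maybe St
  just a  ⊙ just b  = a ⊛ b
  just _  ⊙ nothing = nothing
  nothing ⊙ _       = nothing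

  ⊙-comm : ∀ m n → m ⊙ n ≡ n ⊙ m
  ⊙-comm (just a) (just b) = comm a b
  ⊙-comm (just _) nothing  = refl
  ⊙-comm nothing  (just _) = refl
  ⊙-comm nothing  nothing  = refl

  ⊙-assoc : ∀ m n o → (m ⊙ n) ⊙ o ≡ m ⊙ (n ⊙ o)
  ⊙-assoc (just a) (just b) (just c) = begin
    just a ⊙ just b ⊙ just c           ≡⟨ bindʳ (a ⊛ b) ⟨
    (a ⊛ b >>= λ ab → ab ⊛ c)          ≡⟨ assoc a b c ⟩
    (b ⊛ c >>= λ bc → a ⊛ bc)          ≡⟨ bindˡ (b ⊛ c) ⟩
    just a ⊙ (just b ⊙ just c)         ∎
    where
    bindʳ : ∀ m → (m >>= λ ab → ab ⊛ c) ≡ m ⊙ just c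
    bindʳ (just _) = refl
    bindʳ nothing  = refl
    bindˡ : ∀ m → (m >>= λ bc → a ⊛ bc) ≡ just a ⊙ m
    bindˡ (just _) = refl
    bindˡ nothing  = refl
  ⊙-assoc (just a) (just b) nothing with a ⊛ b
  ... | just _  = refl
  ... | nothing = refl
  ⊙-assoc (just _) nothing _ = refl
  ⊙-assoc nothing  _       _ = refl

  x⊙yz≡y⊙xz : ∀ m n o → m ⊙ (n ⊙ o) ≡ n ⊙ (m ⊙ o)
  x⊙yz≡y⊙xz m n o = begin
    m ⊙ (n ⊙ o)  ≡⟨ ⊙-assoc m n o ⟨
    m ⊙ n ⊙ o    ≡⟨ cong (_⊙ o) (⊙-comm m n) ⟩
    n ⊙ m ⊙ o    ≡⟨ ⊙-assoc n m o ⟩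
    n ⊙ (m ⊙ o)  ∎

  ⊙-identityˡ : ∀ m → just e ⊙ m ≡ m
  ⊙-identityˡ (just a) = unit a
  ⊙-identityˡ nothing  = refl

  ⊙-commutativeMonoid : CommutativeMonoid _ _
  ⊙-commutativeMonoid = record
    { Carrier = Maybe St ; _≈_ = _≡_ ; _∙_ = _⊙_ ; ε = just e
    ; isCommutativeMonoid = isCommutativeMonoidˡ record
      { isSemigroup = record { isMagma = record { isEquivalence = isEquivalence ; ∙-cong = cong₂ _⊙_ } ; assoc = ⊙-assoc }
      ; identityˡ = ⊙-identityˡ
      ; comm      = ⊙-comm
      }
    }

  IsJust : Maybe St → Set
  IsJust m = ∃ λ z → m ≡ just z

  ⊙-just⁻ : ∀ m n {z} → m ⊙ n ≡ just z →
            ∃₂ λ a b → m ≡ just a × n ≡ just b × a ⊛ b ≡ just z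
  ⊙-just⁻ (just a) (just b) eq = a , b , refl , refl , eq

  IsJust-⊙ˡ : ∀ m n → IsJust (m ⊙ n) → IsJust m
  IsJust-⊙ˡ m n (_ , eq) with ⊙-just⁻ m n eq
  ... | a , _ , m≡a , _ = a , m≡a

  ⊙-factorʳ : ∀ a X {N} → just a ⊙ X ≡ just N → ∃ λ F → X ≡ just F × a ⊛ F ≡ just N
  ⊙-factorʳ a X eq with ⊙-just⁻ (just a) X eq
  ... | _ , F , refl , X≡F , aF = F , X≡F , aF

  ≈-⊛-congˡ : ∀ {a a' x ax a'x} → a ≈ a' → a ⊛ x ≡ just ax → a' ⊛ x ≡ just a'x → ax ≈ a'x
  ≈-⊛-congˡ a≈a' ax≡ a'x≡ c = transport a≈a' ax≡ a'x≡ , transport (≈-sym a≈a') a'x≡ ax≡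
    where
    transport : ∀ {a a' x ax a'x} → a ≈ a' → a ⊛ x ≡ just ax → a' ⊛ x ≡ just a'x →
                Defined SA ax c → Defined SA a'x c
    transport {a} {a'} {x} {ax} {a'x} a≈a' ax≡ a'x≡ (axc , axc≡) =
      let (xc , xc≡ , a⊛xc) = ⊙-factorʳ a (just x ⊙ just c)
            (trans (sym (⊙-assoc (just a) (just x) (just c))) (trans (cong (_⊙ just c) ax≡) axc≡))
          (a'xc , a'⊛xc) = ≈⇒defined a≈a' (axc , a⊛xc)
      in a'xc , (begin
        just a'x ⊙ just c            ≡⟨ cong (_⊙ just c) a'x≡ ⟨
        just a' ⊙ just x ⊙ just c    ≡⟨ ⊙-assoc (just a') (just x) (just c) ⟩
        just a' ⊙ (just x ⊙ just c)  ≡⟨ cong (just a' ⊙_) xc≡ ⟩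
        a' ⊛ xc                      ≡⟨ a'⊛xc ⟩
        just a'xc                    ∎)

  ≼-respˡ-≈ : ∀ {N N' ℓ} → N' ≈ N → N ≼ ℓ → N' ≼ ℓ
  ≼-respˡ-≈ N'≈N (s₁ , s₂ , s , s₁≈N , s₂≈ℓ , eq) =
    s₁ , s₂ , s , ≈-trans s₁≈N (≈-sym N'≈N) , s₂≈ℓ , eq

  ≼-respʳ-≈ : ∀ {N ℓ ℓ'} → ℓ' ≈ ℓ → N ≼ ℓ → N ≼ ℓ'
  ≼-respʳ-≈ ℓ'≈ℓ (s₁ , s₂ , s , s₁≈N , s₂≈ℓ , eq) =
    s₁ , s₂ , s , s₁≈N , ≈-trans s₂≈ℓ (≈-sym ℓ'≈ℓ) , eq

  ≼-⊛-defined : ∀ {N ℓ p ℓp} → N ≼ ℓ → ℓ ⊛ p ≡ just ℓp → ∃ λ Np → N ⊛ p ≡ just Np × Np ≼ ℓp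
  ≼-⊛-defined {N} {ℓ} {p} {ℓp} (s₁ , s₂ , s , s₁≈N , s₂≈ℓ , s₁s≡s₂) ℓp≡ =
    let (s₂p , s₂p≡) = ≈⇒defined (≈-sym s₂≈ℓ) (ℓp , ℓp≡)
        s₁ps≡s₂p : just s₁ ⊙ just p ⊙ just s ≡ just s₂p
        s₁ps≡s₂p = begin
          just s₁ ⊙ just p ⊙ just s  ≡⟨ ⊙-assoc (just s₁) (just p) (just s) ⟩
          just s₁ ⊙ (just p ⊙ just s) ≡⟨ cong (just s₁ ⊙_) (⊙-comm (just p) (just s)) ⟩
          just s₁ ⊙ (just s ⊙ just p) ≡⟨ ⊙-assoc (just s₁) (just s) (just p) ⟨
          just s₁ ⊙ just s ⊙ just p  ≡⟨ cong (_⊙ just p) s₁s≡s₂ ⟩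
          s₂ ⊛ p                     ≡⟨ s₂p≡ ⟩
          just s₂p                   ∎
        (s₁p , s₁p≡) = IsJust-⊙ˡ (just s₁ ⊙ just p) (just s) (s₂p , s₁ps≡s₂p)
        (Np , Np≡) = ≈⇒defined s₁≈N (s₁p , s₁p≡)
    in Np , Np≡ , s₁p , s₂p , s , ≈-⊛-congˡ s₁≈N s₁p≡ Np≡ , ≈-⊛-congˡ s₂≈ℓ s₂p≡ ℓp≡ ,
       trans (cong (_⊙ just s) (sym s₁p≡)) s₁ps≡s₂p

  ≼-⊛-cancel : FootprintCancellative SA → ∀ {N ℓ q ℓ' N'} →
               N ≼ ℓ → q ⊛ ℓ' ≡ just ℓ → q ⊛ N' ≡ just N → N' ≼ ℓ'
  ≼-⊛-cancel fc {N} {ℓ} {q} {ℓ'} {N'} (s₁ , s₂ , s , s₁≈N , s₂≈ℓ , s₁s≡s₂) qℓ'≡ qN'≡ =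
    let (Ns , Ns≡) = ≈⇒defined s₁≈N (s₂ , s₁s≡s₂)
        (b , N's≡b , qb≡Ns) = ⊙-factorʳ q (just N' ⊙ just s)
          (trans (sym (⊙-assoc (just q) (just N') (just s))) (trans (cong (_⊙ just s) qN'≡) Ns≡))
        Ns≈ℓ = ≈-trans (≈-⊛-congˡ (≈-sym s₁≈N) Ns≡ s₁s≡s₂) s₂≈ℓ
    in N' , b , s , ≈-refl , fc q b Ns q ℓ' ℓ qb≡Ns qℓ'≡ Ns≈ℓ ≈-refl , N's≡b

punchOutℕ punchInℕ : ℕ → ℕ → ℕ
punchOutℕ zero    j       = pred j
punchOutℕ (suc p) zero    = zero
punchOutℕ (suc p) (suc j) = suc (punchOutℕ p j)
punchInℕ zero    k       = suc k
punchInℕ (suc p) zero    = zero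
punchInℕ (suc p) (suc k) = suc (punchInℕ p k)

punchOutℕ-punchInℕ : ∀ p k → punchOutℕ p (punchInℕ p k) ≡ k
punchOutℕ-punchInℕ zero    k       = refl
punchOutℕ-punchInℕ (suc p) zero    = refl
punchOutℕ-punchInℕ (suc p) (suc k) = cong suc (punchOutℕ-punchInℕ p k)

punchInℕ-punchOutℕ : ∀ {p j} → j ≢ p → punchInℕ p (punchOutℕ p j) ≡ j
punchInℕ-punchOutℕ {zero}  {zero}  j≢p = ⊥-elim (j≢p refl)
punchInℕ-punchOutℕ {zero}  {suc j} _   = refl
punchInℕ-punchOutℕ {suc p} {zero}  _   = refl
punchInℕ-punchOutℕ {suc p} {suc j} j≢p = cong suc (punchInℕ-punchOutℕ (j≢p ∘ cong suc))

punchInℕ≢ : ∀ p k → punchInℕ p k ≢ p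
punchInℕ≢ (suc p) (suc k) eq = punchInℕ≢ p k (cong pred eq)

punchOutℕ-injective : ∀ {p j k} → j ≢ p → k ≢ p → punchOutℕ p j ≡ punchOutℕ p k → j ≡ k
punchOutℕ-injective {p} {j} {k} j≢p k≢p eq = begin
  j                            ≡⟨ punchInℕ-punchOutℕ j≢p ⟨
  punchInℕ p (punchOutℕ p j)   ≡⟨ cong (punchInℕ p) eq ⟩
  punchInℕ p (punchOutℕ p k)   ≡⟨ punchInℕ-punchOutℕ k≢p ⟩
  k                            ∎

punchOutℕ-mono-< : ∀ {p j k} → j < k → j ≢ p → k ≢ p → punchOutℕ p j < punchOutℕ p k
punchOutℕ-mono-< {zero}  {zero}          _         j≢p _   = ⊥-elim (j≢p refl)
punchOutℕ-mono-< {zero}  {suc j} {suc k} (s≤s j<k) _   _   = j<k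
punchOutℕ-mono-< {suc p} {zero}  {suc k} _         _   _   = s≤s z≤n
punchOutℕ-mono-< {suc p} {suc j} {suc k} (s≤s j<k) j≢p k≢p =
  s≤s (punchOutℕ-mono-< j<k (j≢p ∘ cong suc) (k≢p ∘ cong suc))

module _ {X : Set} where
  lookupℕ : List X → ℕ → Maybe X
  lookupℕ []       _       = nothing
  lookupℕ (x ∷ xs) zero    = just x
  lookupℕ (x ∷ xs) (suc n) = lookupℕ xs n

  removeAtℕ : List X → ℕ → List X
  removeAtℕ []       _       = []
  removeAtℕ (x ∷ xs) zero    = xs
  removeAtℕ (x ∷ xs) (suc p) = x ∷ removeAtℕ xs p

  lookupℕ-removeAtℕ : ∀ xs p k → lookupℕ (removeAtℕ xs p) k ≡ lookupℕ xs (punchInℕ p k)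
  lookupℕ-removeAtℕ []       p       k       = refl
  lookupℕ-removeAtℕ (x ∷ xs) zero    k       = refl
  lookupℕ-removeAtℕ (x ∷ xs) (suc p) zero    = refl
  lookupℕ-removeAtℕ (x ∷ xs) (suc p) (suc k) = lookupℕ-removeAtℕ xs p k

  lookupℕ-split : ∀ xs p {x} → lookupℕ xs p ≡ just x →
    xs ≡ take p xs ++ x ∷ drop (suc p) xs × removeAtℕ xs p ≡ take p xs ++ drop (suc p) xs
  lookupℕ-split (y ∷ xs) zero    refl = refl , refl
  lookupℕ-split (y ∷ xs) (suc p) eq   = Product.map (cong (y ∷_)) (cong (y ∷_)) (lookupℕ-split xs p eq)

  All-take : ∀ {Q : X → Set} xs p → (∀ {j x} → j < p → lookupℕ xs j ≡ just x → Q x) → All Q (take p xs)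
  All-take xs       zero    _ = []
  All-take []       (suc p) _ = []
  All-take (x ∷ xs) (suc p) h = h (s≤s z≤n) refl ∷ All-take xs p (h ∘ s≤s)

  lookupℕ-toℕ : ∀ xs (i : Fin (length xs)) → lookupℕ xs (toℕ i) ≡ just (lookup xs i)
  lookupℕ-toℕ (x ∷ xs) zero    = refl
  lookupℕ-toℕ (x ∷ xs) (suc i) = lookupℕ-toℕ xs i

  lookupℕ-just⁻ : ∀ xs n {x} → lookupℕ xs n ≡ just x → Σ (n < length xs) λ n< → lookup xs (fromℕ< n<) ≡ x
  lookupℕ-just⁻ (y ∷ xs) zero    refl = s≤s z≤n , refl
  lookupℕ-just⁻ (y ∷ xs) (suc n) eq   = Product.map s≤s id (lookupℕ-just⁻ xs n eq)

module _ {S M : Set} where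
  OrderConstraint : IAct S M → IAct S M → Set
  OrderConstraint a b = IThread a ≡ IThread b ⊎ IsRet a × IsCall b

  -- ⊑H with the bijection of positions replaced by a function on ℕ, whose
  -- values at invalid positions are junk
  record IndexEmbedding (H P : History S M) : Set where
    field
      ρ          : ℕ → ℕ
      lookup-ρ   : ∀ {i a} → lookupℕ H i ≡ just a → lookupℕ P (ρ i) ≡ just a
      injective  : ∀ {i j a b} → lookupℕ H i ≡ just a → lookupℕ H j ≡ just b → ρ i ≡ ρ j → i ≡ j
      surjective : ∀ {j b} → lookupℕ P j ≡ just b → ∃₂ λ i a → lookupℕ H i ≡ just a × ρ i ≡ j
      monotone   : ∀ {i j a b} → i < j → lookupℕ H i ≡ just a → lookupℕ H j ≡ just b →
                   OrderConstraint a b → ρ i < ρ j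

  data Extraction : History S M → History S M → Set where
    []      : Extraction [] []
    extract : ∀ {x H P} A B → P ≡ A ++ x ∷ B → All (λ a → ¬ OrderConstraint x a) A →
              Extraction H (A ++ B) → Extraction (x ∷ H) P

  ⊑H⇒IndexEmbedding : ∀ {H P} → H ⊑H P → IndexEmbedding H P
  ⊑H⇒IndexEmbedding {H} {P} (ρ⤖ , lookup-ρ⤖ , monotone-ρ⤖) = record
    { ρ = ρ ; lookup-ρ = lookup-ρ ; injective = injective ; surjective = surjective ; monotone = monotone }
    where
    open Bijection ρ⤖ using () renaming (to to ρᶠ; injective to injectiveᶠ; surjective to surjectiveᶠ)
    ρ : ℕ → ℕ
    ρ n with n <? length H
    ... | yes n< = toℕ (ρᶠ (fromℕ< n<))
    ... | no  _  = 0
    ρ-fromℕ< : ∀ {n} (n< : n < length H) → ρ n ≡ toℕ (ρᶠ (fromℕ< n<))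
    ρ-fromℕ< {n} n< with n <? length H
    ... | yes _  = cong (toℕ ∘ ρᶠ) (fromℕ<-cong n n refl _ n<)
    ... | no  n≮ = ⊥-elim (n≮ n<)
    lookup-ρ : ∀ {i a} → lookupℕ H i ≡ just a → lookupℕ P (ρ i) ≡ just a
    lookup-ρ {i} eq with lookupℕ-just⁻ H i eq
    ... | i< , refl = trans (cong (lookupℕ P) (ρ-fromℕ< i<))
                            (trans (lookupℕ-toℕ P _) (cong just (sym (lookup-ρ⤖ _))))
    injective : ∀ {i j a b} → lookupℕ H i ≡ just a → lookupℕ H j ≡ just b → ρ i ≡ ρ j → i ≡ j
    injective {i} {j} eqi eqj ρi≡ρj =
      let (i< , _) = lookupℕ-just⁻ H i eqi ; (j< , _) = lookupℕ-just⁻ H j eqj in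
      trans (sym (toℕ-fromℕ< i<)) (trans (cong toℕ (injectiveᶠ (toℕ-injective
        (trans (sym (ρ-fromℕ< i<)) (trans ρi≡ρj (ρ-fromℕ< j<)))))) (toℕ-fromℕ< j<))
    surjective : ∀ {j b} → lookupℕ P j ≡ just b → ∃₂ λ i a → lookupℕ H i ≡ just a × ρ i ≡ j
    surjective {j} eq with lookupℕ-just⁻ P j eq
    ... | j< , _ with surjectiveᶠ (fromℕ< j<)
    ... | i , ρi≡ = toℕ i , lookup H i , lookupℕ-toℕ H i , (begin
      ρ (toℕ i)                         ≡⟨ ρ-fromℕ< (toℕ<n i) ⟩
      toℕ (ρᶠ (fromℕ< (toℕ<n i)))      ≡⟨ cong (toℕ ∘ ρᶠ) (fromℕ<-toℕ i (toℕ<n i)) ⟩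
      toℕ (ρᶠ i)                        ≡⟨ cong toℕ (ρi≡ refl) ⟩
      toℕ (fromℕ< j<)                   ≡⟨ toℕ-fromℕ< j< ⟩
      j                                 ∎)
    monotone : ∀ {i j a b} → i < j → lookupℕ H i ≡ just a → lookupℕ H j ≡ just b →
               OrderConstraint a b → ρ i < ρ j
    monotone {i} {j} i<j eqi eqj c with lookupℕ-just⁻ H i eqi | lookupℕ-just⁻ H j eqj
    ... | i< , refl | j< , refl =
      subst₂ _<_ (sym (ρ-fromℕ< i<)) (sym (ρ-fromℕ< j<))
        (monotone-ρ⤖ (fromℕ< i<) (fromℕ< j<) (subst₂ _<_ (sym (toℕ-fromℕ< i<)) (sym (toℕ-fromℕ< j<)) i<j) c)

  IndexEmbedding-tail : ∀ {x H P} (E : IndexEmbedding (x ∷ H) P) →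
                        IndexEmbedding H (removeAtℕ P (IndexEmbedding.ρ E 0))
  IndexEmbedding-tail {x} {H} {P} E = record
    { ρ = ρ'
    ; lookup-ρ = λ eq → trans (lookupℕ-removeAtℕ P p _)
                           (trans (cong (lookupℕ P) (punchInℕ-punchOutℕ (ρ≢p eq))) (lookup-ρ eq))
    ; injective = λ eqi eqj eq → cong pred (injective eqi eqj (punchOutℕ-injective (ρ≢p eqi) (ρ≢p eqj) eq))
    ; surjective = surjective'
    ; monotone = λ i<j eqi eqj c → punchOutℕ-mono-< (monotone (s≤s i<j) eqi eqj c) (ρ≢p eqi) (ρ≢p eqj)
    }
    where
    open IndexEmbedding E
    p = ρ 0
    ρ' : ℕ → ℕ
    ρ' i = punchOutℕ p (ρ (suc i))
    ρ≢p : ∀ {i a} → lookupℕ H i ≡ just a → ρ (suc i) ≢ p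
    ρ≢p eq ρi≡p with injective eq refl ρi≡p
    ... | ()
    surjective' : ∀ {k b} → lookupℕ (removeAtℕ P p) k ≡ just b → ∃₂ λ i a → lookupℕ H i ≡ just a × ρ' i ≡ k
    surjective' {k} eq with surjective (trans (sym (lookupℕ-removeAtℕ P p k)) eq)
    ... | zero  , _ , _  , ρ0≡ = ⊥-elim (punchInℕ≢ p k (sym ρ0≡))
    ... | suc i , a , eq , ρi≡ = i , a , eq , trans (cong (punchOutℕ p) ρi≡) (punchOutℕ-punchInℕ p k)

  -- Elements of P before ρ 0 are images of later elements of x ∷ H, so
  -- monotonicity forbids a constraint with x.
  IndexEmbedding-prefix : ∀ {x H P} (E : IndexEmbedding (x ∷ H) P) →
    All (λ a → ¬ OrderConstraint x a) (take (IndexEmbedding.ρ E 0) P)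
  IndexEmbedding-prefix {x} {H} {P} E = All-take P p unconstrained
    where
    open IndexEmbedding E
    p = ρ 0
    unconstrained : ∀ {j b} → j < p → lookupℕ P j ≡ just b → ¬ OrderConstraint x b
    unconstrained {j} j<p eq c with surjective eq
    ... | zero  , _ , _   , ρ0≡j = <-irrefl (sym ρ0≡j) j<p
    ... | suc i , a , eqi , ρi≡j with trans (sym (lookup-ρ eqi)) (trans (cong (lookupℕ P) ρi≡j) eq)
    ... | refl = <-asym j<p (subst (p <_) ρi≡j (monotone (s≤s z≤n) refl eqi c))

  IndexEmbedding⇒Extraction : ∀ {H P} → IndexEmbedding H P → Extraction H P
  IndexEmbedding⇒Extraction {[]} {[]} E = []
  IndexEmbedding⇒Extraction {[]} {b ∷ P} E with IndexEmbedding.surjective E {0} refl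
  ... | _ , _ , () , _
  IndexEmbedding⇒Extraction {x ∷ H} {P} E =
    extract (take p P) (drop (suc p) P) P≡ (IndexEmbedding-prefix E)
      (subst (Extraction H) P∖p≡ (IndexEmbedding⇒Extraction (IndexEmbedding-tail E)))
    where
    p = IndexEmbedding.ρ E 0
    P≡ = proj₁ (lookupℕ-split P p (IndexEmbedding.lookup-ρ E refl))
    P∖p≡ = proj₂ (lookupℕ-split P p (IndexEmbedding.lookup-ρ E refl))

module Traces (SA : SepAlg) (P : Prims SA) {M : Set} (Γ : Spec SA M) where
  open Sem SA P Γ
  open Prims P using (Cmd)

  thread : Act → Tid
  thread (callA t _) = t
  thread (retA t _)  = t
  thread (cmdA t _)  = t

  data Swap : List Act → List Act → Set where
    here  : ∀ {a b τ} → thread a ≢ thread b → Swap (a ∷ b ∷ τ) (b ∷ a ∷ τ)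
    there : ∀ {c τ τ'} → Swap τ τ' → Swap (c ∷ τ) (c ∷ τ')

  Swaps : List Act → List Act → Set
  Swaps = Star Swap

  Swaps-++ˡ : ∀ τ₀ {τ τ'} → Swaps τ τ' → Swaps (τ₀ ++ τ) (τ₀ ++ τ')
  Swaps-++ˡ τ₀ = Star.gmap (τ₀ ++_) (swap-++ˡ τ₀)
    where
    swap-++ˡ : ∀ τ₀ {τ τ'} → Swap τ τ' → Swap (τ₀ ++ τ) (τ₀ ++ τ')
    swap-++ˡ []       s = s
    swap-++ˡ (c ∷ τ₀) s = there (swap-++ˡ τ₀ s)

  Swaps-≡ : ∀ {τ τ' τ''} → τ' ≡ τ'' → Swaps τ τ' → Swaps τ τ''
  Swaps-≡ refl ss = ss

  Swaps-moveToFront : ∀ B {a τ} → All (λ b → thread b ≢ thread a) B → Swaps (B ++ a ∷ τ) (a ∷ B ++ τ)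
  Swaps-moveToFront []      []         = ε
  Swaps-moveToFront (b ∷ B) (b≢a ∷ B≢a) = Swaps-++ˡ (b ∷ []) (Swaps-moveToFront B B≢a) ◅◅ (here b≢a ◅ ε)

  All-interleave : ∀ {Q : Act → Set} {l r τ} → Interleaving l r τ → All Q l → All Q r → All Q τ
  All-interleave []          _          _          = []
  All-interleave (consˡ lrτ) (ql ∷ Ql) Qr         = ql ∷ All-interleave lrτ Ql Qr
  All-interleave (consʳ lrτ) Ql         (qr ∷ Qr) = qr ∷ All-interleave lrτ Ql Qr

  module _ (L : Library Cmd M) where
    ThreadTr-thread : ∀ {t τ} → ThreadTr L t τ → All (λ a → thread a ≡ t) τ
    ThreadTr-thread done = []
    ThreadTr-thread {t} (invoke m τ rest _ tr) =
      refl ∷ All.++⁺ (All.map⁺ (All.universal (λ _ → refl) τ)) (refl ∷ ThreadTr-thread tr)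

    AllThreads-thread≤ : ∀ k {τ} → AllThreads L k τ → All (λ a → thread a ≤ k) τ
    AllThreads-thread≤ zero    refl = []
    AllThreads-thread≤ (suc k) (_ , _ , tr , at , il) =
      All-interleave il (All.map ≤-reflexive (ThreadTr-thread tr))
                        (All.map m≤n⇒m≤1+n (AllThreads-thread≤ k at))

    Interleaving-swap : ∀ {T l r τ τ'} → Interleaving l r τ → All (λ a → thread a ≡ T) l → Swap τ τ' →
                        ∃ λ r' → Interleaving l r' τ' × (r' ≡ r ⊎ Swap r r')
    Interleaving-swap (consˡ (consˡ _))   (eq₁ ∷ eq₂ ∷ _) (here a≢b) = ⊥-elim (a≢b (trans eq₁ (sym eq₂)))
    Interleaving-swap (consˡ (consʳ lrτ)) _               (here _)   = _ , consʳ (consˡ lrτ) , inj₁ refl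
    Interleaving-swap (consʳ (consˡ lrτ)) _               (here _)   = _ , consˡ (consʳ lrτ) , inj₁ refl
    Interleaving-swap (consʳ (consʳ lrτ)) _               (here a≢b) = _ , consʳ (consʳ lrτ) , inj₂ (here a≢b)
    Interleaving-swap (consˡ lrτ) (_ ∷ Tl) (there s) with Interleaving-swap lrτ Tl s
    ... | r' , lr'τ' , r'≡r⊎swap = r' , consˡ lr'τ' , r'≡r⊎swap
    Interleaving-swap (consʳ lrτ) Tl (there s) with Interleaving-swap lrτ Tl s
    ... | _ , lr'τ' , inj₁ refl = _ , consʳ lr'τ' , inj₁ refl
    ... | _ , lr'τ' , inj₂ s'   = _ , consʳ lr'τ' , inj₂ (there s')

    AllThreads-swap : ∀ k {τ τ'} → AllThreads L k τ → Swap τ τ' → AllThreads L k τ'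
    AllThreads-swap zero    refl ()
    AllThreads-swap (suc k) (τ₁ , τ₂ , tr , at , il) s with Interleaving-swap il (ThreadTr-thread tr) s
    ... | _ , il' , inj₁ refl = τ₁ , τ₂ , tr , at , il'
    ... | _ , il' , inj₂ s'   = τ₁ , _ , tr , AllThreads-swap k at s' , il'

    AllThreads-swaps : ∀ k {τ τ'} → AllThreads L k τ → Swaps τ τ' → AllThreads L k τ'
    AllThreads-swaps k at ε        = at
    AllThreads-swaps k at (s ◅ ss) = AllThreads-swaps k (AllThreads-swap k at s) ss

  -- which threads are currently inside a method call
  Status : Set
  Status = Tid → Bool

  update : Status → Tid → Bool → Status
  update st t b u with t ≟ u
  ... | yes _ = b
  ... | no  _ = st u

  update-same : ∀ st t b → update st t b t ≡ b
  update-same st t b with t ≟ t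
  ... | yes _   = refl
  ... | no  t≢t = ⊥-elim (t≢t refl)

  update-other : ∀ st {t u} b → t ≢ u → update st t b u ≡ st u
  update-other st {t} {u} b t≢u with t ≟ u
  ... | yes t≡u = ⊥-elim (t≢u t≡u)
  ... | no  _   = refl

  update-cong : ∀ {st st'} t b → (∀ u → st u ≡ st' u) → ∀ u → update st t b u ≡ update st' t b u
  update-cong t b st≗st' u with t ≟ u
  ... | yes _ = refl
  ... | no  _ = st≗st' u

  update-comm : ∀ st {t T} b v → t ≢ T → ∀ u → update (update st T v) t b u ≡ update (update st t b) T v u
  update-comm st {t} {T} b v t≢T u = by-cases (t ≟ u) (T ≟ u)
    where
    by-cases : Dec (t ≡ u) → Dec (T ≡ u) → update (update st T v) t b u ≡ update (update st t b) T v u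
    by-cases (yes refl) (yes refl) = ⊥-elim (t≢T refl)
    by-cases (yes refl) (no T≢u)   =
      trans (update-same (update st T v) u b) (sym (trans (update-other (update st u b) v T≢u) (update-same st u b)))
    by-cases (no t≢u)   (yes refl) =
      trans (trans (update-other (update st u v) b t≢u) (update-same st u v)) (sym (update-same (update st t b) u v))
    by-cases (no t≢u)   (no T≢u)   =
      trans (trans (update-other (update st T v) b t≢u) (update-other st v T≢u))
            (sym (trans (update-other (update st t b) v T≢u) (update-other st b t≢u)))

  data WellFormed (st : Status) : List Act → Set where
    []   : WellFormed st []
    call : ∀ {t m τ} → st t ≡ false → WellFormed (update st t true) τ → WellFormed st (callA t m ∷ τ)
    ret  : ∀ {t m τ} → st t ≡ true → WellFormed (update st t false) τ → WellFormed st (retA t m ∷ τ)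
    cmd  : ∀ {t c τ} → st t ≡ true → WellFormed st τ → WellFormed st (cmdA t c ∷ τ)

  WellFormed-cong : ∀ {st st' τ} → (∀ u → st u ≡ st' u) → WellFormed st τ → WellFormed st' τ
  WellFormed-cong st≗st' []                 = []
  WellFormed-cong st≗st' (call {t} eq wf) = call (trans (sym (st≗st' t)) eq) (WellFormed-cong (update-cong t true st≗st') wf)
  WellFormed-cong st≗st' (ret {t} eq wf)  = ret (trans (sym (st≗st' t)) eq) (WellFormed-cong (update-cong t false st≗st') wf)
  WellFormed-cong st≗st' (cmd {t} eq wf)  = cmd (trans (sym (st≗st' t)) eq) (WellFormed-cong st≗st' wf)

  WellFormed-update-other : ∀ {st τ T} v → All (λ a → thread a ≢ T) τ → WellFormed st τ → WellFormed (update st T v) τ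
  WellFormed-update-other v _ [] = []
  WellFormed-update-other {st} v (t≢T ∷ τ≢T) (call eq wf) =
    call (trans (update-other st v (t≢T ∘ sym)) eq)
         (WellFormed-cong (sym ∘ update-comm st true v t≢T) (WellFormed-update-other v τ≢T wf))
  WellFormed-update-other {st} v (t≢T ∷ τ≢T) (ret eq wf) =
    ret (trans (update-other st v (t≢T ∘ sym)) eq)
        (WellFormed-cong (sym ∘ update-comm st false v t≢T) (WellFormed-update-other v τ≢T wf))
  WellFormed-update-other {st} v (t≢T ∷ τ≢T) (cmd eq wf) =
    cmd (trans (update-other st v (t≢T ∘ sym)) eq) (WellFormed-update-other v τ≢T wf)

  data Alternating (T : Tid) : Bool → List Act → Set where
    []   : ∀ {b} → Alternating T b []
    call : ∀ {m τ} → Alternating T true τ → Alternating T false (callA T m ∷ τ)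
    cmd  : ∀ {c τ} → Alternating T true τ → Alternating T true (cmdA T c ∷ τ)
    ret  : ∀ {m τ} → Alternating T false τ → Alternating T true (retA T m ∷ τ)

  WellFormed-interleave : ∀ {T b l r τ st} → Interleaving l r τ → Alternating T b l → WellFormed st r →
                          All (λ a → thread a ≢ T) r → st T ≡ b → WellFormed st τ
  WellFormed-interleave [] _ _ _ _ = []
  WellFormed-interleave {T} {st = st} (consˡ lrτ) (call alt) wf r≢T eq =
    call eq (WellFormed-interleave lrτ alt (WellFormed-update-other true r≢T wf) r≢T (update-same st T true))
  WellFormed-interleave (consˡ lrτ) (cmd alt) wf r≢T eq =
    cmd eq (WellFormed-interleave lrτ alt wf r≢T eq)
  WellFormed-interleave {T} {st = st} (consˡ lrτ) (ret alt) wf r≢T eq =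
    ret eq (WellFormed-interleave lrτ alt (WellFormed-update-other false r≢T wf) r≢T (update-same st T false))
  WellFormed-interleave {st = st} (consʳ lrτ) alt (call eq' wf) (t≢T ∷ r≢T) eq =
    call eq' (WellFormed-interleave lrτ alt wf r≢T (trans (update-other st true t≢T) eq))
  WellFormed-interleave {st = st} (consʳ lrτ) alt (ret eq' wf) (t≢T ∷ r≢T) eq =
    ret eq' (WellFormed-interleave lrτ alt wf r≢T (trans (update-other st false t≢T) eq))
  WellFormed-interleave (consʳ lrτ) alt (cmd eq' wf) (_ ∷ r≢T) eq =
    cmd eq' (WellFormed-interleave lrτ alt wf r≢T eq)

  module _ (L : Library Cmd M) where
    ThreadTr-alternating : ∀ {t τ} → ThreadTr L t τ → Alternating t false τ
    ThreadTr-alternating done = []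
    ThreadTr-alternating (invoke m τ rest _ tr) = call (body τ)
      where
      body : ∀ τ → Alternating _ true (map (cmdA _) τ ++ retA _ m ∷ rest)
      body []      = ret (ThreadTr-alternating tr)
      body (c ∷ τ) = cmd (body τ)

    AllThreads-wellFormed : ∀ k {τ} → AllThreads L k τ → WellFormed (λ _ → false) τ
    AllThreads-wellFormed zero    refl = []
    AllThreads-wellFormed (suc k) (_ , _ , tr , at , il) =
      WellFormed-interleave il (ThreadTr-alternating tr) (AllThreads-wellFormed k at)
        (All.map (λ t≤k t≡ → <-irrefl t≡ (s≤s t≤k)) (AllThreads-thread≤ L k at)) refl

  Swaps-emit : ∀ {τ} emitted A {a} R → All (λ b → thread b ≢ thread a) A →
               Swaps τ (emitted ++ A ++ a ∷ R) → Swaps τ ((emitted ++ a ∷ []) ++ A ++ R)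
  Swaps-emit emitted A {a} R A≢a ss =
    Swaps-≡ (sym (++-assoc emitted (a ∷ []) (A ++ R))) (ss ◅◅ Swaps-++ˡ emitted (Swaps-moveToFront A A≢a))

module _ {X : Set} where
  ++-≡-++∷ : ∀ (Xs Ys A B : List X) {x} → Xs ++ Ys ≡ A ++ x ∷ B →
             (∃ λ X₂ → Xs ≡ A ++ x ∷ X₂ × B ≡ X₂ ++ Ys) ⊎
             (∃ λ Y₁ → Ys ≡ Y₁ ++ x ∷ B × A ≡ Xs ++ Y₁)
  ++-≡-++∷ []       Ys A       B eq = inj₂ (A , eq , refl)
  ++-≡-++∷ (_ ∷ Xs) Ys []      B eq = inj₁ (Xs , cong (_∷ Xs) (∷-injectiveˡ eq) , sym (∷-injectiveʳ eq))
  ++-≡-++∷ (_ ∷ Xs) Ys (_ ∷ A) B eq with ++-≡-++∷ Xs Ys A B (∷-injectiveʳ eq)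
  ... | inj₁ (X₂ , Xs≡ , B≡) = inj₁ (X₂ , cong₂ _∷_ (∷-injectiveˡ eq) Xs≡ , B≡)
  ... | inj₂ (Y₁ , Ys≡ , A≡) = inj₂ (Y₁ , Ys≡ , cong₂ _∷_ (sym (∷-injectiveˡ eq)) A≡)

  []≢++∷ : ∀ (A : List X) {x B} → [] ≢ A ++ x ∷ B
  []≢++∷ []      ()
  []≢++∷ (_ ∷ _) ()

  All-removeMiddle : ∀ {Q : X → Set} xs {y ys} → All Q (xs ++ y ∷ ys) → All Q (xs ++ ys)
  All-removeMiddle xs Qs with All.++⁻ xs Qs
  ... | Qxs , _ ∷ Qys = All.++⁺ Qxs Qys

  Any-insertMiddle : ∀ {Q : X → Set} xs {y ys} → Any Q (xs ++ ys) → Any Q (xs ++ y ∷ ys)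
  Any-insertMiddle xs = Sum.[ Any.++⁺ˡ , Any.++⁺ʳ xs ∘ there ] ∘ Any.++⁻ xs

module _ {X Y : Set} where
  map-≡-++∷ : ∀ (g : X → Y) D A {y} B → map g D ≡ A ++ y ∷ B →
    ∃₂ λ D₁ d → ∃ λ D₂ → D ≡ D₁ ++ d ∷ D₂ × map g D₁ ≡ A × g d ≡ y × map g D₂ ≡ B
  map-≡-++∷ g []      A       B eq = ⊥-elim ([]≢++∷ A eq)
  map-≡-++∷ g (d ∷ D) []      B eq = [] , d , D , refl , refl , ∷-injectiveˡ eq , ∷-injectiveʳ eq
  map-≡-++∷ g (d ∷ D) (_ ∷ A) B eq with map-≡-++∷ g D A B (∷-injectiveʳ eq)
  ... | D₁ , d' , D₂ , D≡ , A≡ , y≡ , B≡ =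
    d ∷ D₁ , d' , D₂ , cong (d ∷_) D≡ , cong₂ _∷_ (∷-injectiveˡ eq) A≡ , y≡ , B≡

module Rearrangement (SA : SepAlg) (fc : FootprintCancellative SA) (P : Prims SA) {M : Set} (Γ : Spec SA M) where
  open SepAlg SA
  open Prims P
  open Spec Γ
  open Sem SA P Γ
  open Footprint SA
  open Traces SA P Γ
  open import Algebra.Solver.CommutativeMonoid ⊙-commutativeMonoid using (solve; _⊕_; _⊜_) renaming (id to ε⊕)

  ∈O⇒≈ : ∀ {t c σ σ'} → σ' ∈O f t c σ → σ' ≈ σ
  ∈O⇒≈ {t} {c} {σ} {σ'} σ'∈ with f t c σ in eq
  ... | ok Q = footprint-preservation t c σ Q σ' eq σ'∈

  ∈O-frame : ∀ {t c σ σ' F N} → σ' ∈O f t c σ → σ ⊛ F ≡ just N →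
             ∃ λ N' → σ' ⊛ F ≡ just N' × N' ∈O f t c N
  ∈O-frame {t} {c} {σ} {σ'} {F} {N} σ'∈ σF≡N with f t c σ in eq
  ... | ok Q with strong-locality t c σ F N Q σF≡N eq
  ... | Q' , fN≡Q' , Q'⇔ =
    let (N' , σ'F≡N') = ≈⇒defined (≈-sym (footprint-preservation t c σ Q σ' eq σ'∈)) (N , σF≡N)
    in N' , σ'F≡N' , subst (N' ∈O_) (sym fN≡Q') (Equivalence.from (Q'⇔ N') (σ' , σ'∈ , σ'F≡N'))

  -- ⟦H⟧♯ ℓ is defined, footprints being represented by states
  Balanced : St → History St M → Set
  Balanced ℓ []               = ⊤
  Balanced ℓ (call _ _ p ∷ H) = ∃₂ λ ℓ₁ ℓ₂ → ℓ₁ ≈ ℓ × ℓ₁ ⊛ p ≡ just ℓ₂ × Balanced ℓ₂ H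
  Balanced ℓ (ret _ _ q ∷ H)  = ∃₂ λ ℓ₁ ℓ₂ → ℓ₁ ≈ ℓ × q ⊛ ℓ₂ ≡ just ℓ₁ × Balanced ℓ₂ H

  Balanced-resp-≈ : ∀ {ℓ ℓ'} H → ℓ' ≈ ℓ → Balanced ℓ H → Balanced ℓ' H
  Balanced-resp-≈ []               _    _                         = tt
  Balanced-resp-≈ (call _ _ _ ∷ _) ℓ'≈ℓ (ℓ₁ , ℓ₂ , ℓ₁≈ℓ , eq , b) = ℓ₁ , ℓ₂ , ≈-trans ℓ₁≈ℓ (≈-sym ℓ'≈ℓ) , eq , b
  Balanced-resp-≈ (ret _ _ _ ∷ _)  ℓ'≈ℓ (ℓ₁ , ℓ₂ , ℓ₁≈ℓ , eq , b) = ℓ₁ , ℓ₂ , ≈-trans ℓ₁≈ℓ (≈-sym ℓ'≈ℓ) , eq , b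

  Admits : St → History St M → Set
  Admits N H = ∃ λ ℓ → N ≼ ℓ × Balanced ℓ H

  Admits-resp-≈ : ∀ {N N' H} → N' ≈ N → Admits N H → Admits N' H
  Admits-resp-≈ N'≈N (ℓ , N≼ℓ , bal) = ℓ , ≼-respˡ-≈ N'≈N N≼ℓ , bal

  Admits-call : ∀ {N t m p H} → Admits N (call t m p ∷ H) → ∃ λ N' → N ⊛ p ≡ just N' × Admits N' H
  Admits-call (ℓ , N≼ℓ , ℓ₁ , ℓ₂ , ℓ₁≈ℓ , ℓ₁p≡ℓ₂ , bal)
    with ≼-⊛-defined (≼-respʳ-≈ ℓ₁≈ℓ N≼ℓ) ℓ₁p≡ℓ₂
  ... | N' , Np≡N' , N'≼ℓ₂ = N' , Np≡N' , ℓ₂ , N'≼ℓ₂ , bal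

  Admits-ret : ∀ {N N' t m q H} → Admits N (ret t m q ∷ H) → q ⊛ N' ≡ just N → Admits N' H
  Admits-ret (ℓ , N≼ℓ , ℓ₁ , ℓ₂ , ℓ₁≈ℓ , qℓ₂≡ℓ₁ , bal) qN'≡N =
    ℓ₂ , ≼-⊛-cancel fc (≼-respʳ-≈ ℓ₁≈ℓ N≼ℓ) qℓ₂≡ℓ₁ qN'≡N , bal

  Run⇒Balanced : ∀ {σ τ σ' α} → Run σ τ σ' α → Balanced σ (history α)
  Run⇒Balanced r-nil                      = tt
  Run⇒Balanced (r-cons (s-cmd σ₁∈) run)   = Balanced-resp-≈ _ (≈-sym (∈O⇒≈ σ₁∈)) (Run⇒Balanced run)
  Run⇒Balanced (r-cons (s-call _ eq) run) = _ , _ , ≈-refl , eq , Run⇒Balanced run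
  Run⇒Balanced (r-cons (s-ret _ eq) run)  = _ , _ , ≈-refl , eq , Run⇒Balanced run

  -- The rest of a run of the original trace, in which some calls have already
  -- been performed ahead of time ("hoisted") by the rearranged run.
  data Residual : St → Set where
    []      : ∀ {σ} → Residual σ
    cmd     : ∀ {σ σ'} t c → σ' ∈O f t c σ → Residual σ' → Residual σ
    call    : ∀ {σ σ'} t m p → pre m t p → σ ⊛ p ≡ just σ' → Residual σ' → Residual σ
    hoisted : ∀ {σ σ'} (t : Tid) (m : M) p → σ ⊛ p ≡ just σ' → Residual σ' → Residual σ
    ret     : ∀ {σ σ'} t m q → post m t q → q ⊛ σ' ≡ just σ → Residual σ' → Residual σ

  actions pendingActions : ∀ {σ} → Residual σ → List Act
  actions []                    = []
  actions (cmd t c _ r)         = cmdA t c ∷ actions r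
  actions (call t m _ _ _ r)    = callA t m ∷ actions r
  actions (hoisted t m _ _ r)   = callA t m ∷ actions r
  actions (ret t m _ _ _ r)     = retA t m ∷ actions r
  pendingActions []                  = []
  pendingActions (cmd t c _ r)       = cmdA t c ∷ pendingActions r
  pendingActions (call t m _ _ _ r)  = callA t m ∷ pendingActions r
  pendingActions (hoisted _ _ _ _ r) = pendingActions r
  pendingActions (ret t m _ _ _ r)   = retA t m ∷ pendingActions r

  pendingHistory : ∀ {σ} → Residual σ → History St M
  pendingHistory []                  = []
  pendingHistory (cmd _ _ _ r)       = pendingHistory r
  pendingHistory (call t m p _ _ r)  = call t m p ∷ pendingHistory r
  pendingHistory (hoisted _ _ _ _ r) = pendingHistory r
  pendingHistory (ret t m q _ _ r)   = ret t m q ∷ pendingHistory r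

  hoistedResources : ∀ {σ} → Residual σ → List St
  hoistedResources []                  = []
  hoistedResources (cmd _ _ _ r)       = hoistedResources r
  hoistedResources (call _ _ _ _ _ r)  = hoistedResources r
  hoistedResources (hoisted _ _ p _ r) = p ∷ hoistedResources r
  hoistedResources (ret _ _ _ _ _ r)   = hoistedResources r

  size : ∀ {σ} → Residual σ → ℕ
  size []                  = 0
  size (cmd _ _ _ r)       = suc (size r)
  size (call _ _ _ _ _ r)  = suc (size r)
  size (hoisted _ _ _ _ r) = suc (size r)
  size (ret _ _ _ _ _ r)   = suc (size r)

  -- No hoisted call has a Blocked thread or a pending event of its own
  -- thread before it.
  Unblocked : ∀ {σ} → (Tid → Set) → Residual σ → Set
  Unblocked Blocked []                  = ⊤
  Unblocked Blocked (cmd _ _ _ r)       = Unblocked Blocked r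
  Unblocked Blocked (call t _ _ _ _ r)  = Unblocked (λ u → u ≡ t ⊎ Blocked u) r
  Unblocked Blocked (hoisted t _ _ _ r) = ¬ Blocked t × Unblocked Blocked r
  Unblocked Blocked (ret t _ _ _ _ r)   = Unblocked (λ u → u ≡ t ⊎ Blocked u) r

  Unblocked-anti : ∀ {σ} {Blocked Blocked' : Tid → Set} (r : Residual σ) →
                   (∀ {u} → Blocked' u → Blocked u) → Unblocked Blocked r → Unblocked Blocked' r
  Unblocked-anti []                  _   _            = tt
  Unblocked-anti (cmd _ _ _ r)       B⊆B ub           = Unblocked-anti r B⊆B ub
  Unblocked-anti (call _ _ _ _ _ r)  B⊆B ub           = Unblocked-anti r (Sum.map₂ B⊆B) ub
  Unblocked-anti (hoisted _ _ _ _ r) B⊆B (¬Bt , ub)   = ¬Bt ∘ B⊆B , Unblocked-anti r B⊆B ub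
  Unblocked-anti (ret _ _ _ _ _ r)   B⊆B ub           = Unblocked-anti r (Sum.map₂ B⊆B) ub

  toResidual : ∀ {σ τ σ' α} → Run σ τ σ' α → Residual σ
  toResidual r-nil                                    = []
  toResidual (r-cons (s-cmd {t} {c} σ₁∈) run)         = cmd t c σ₁∈ (toResidual run)
  toResidual (r-cons (s-call {t} {m} {σp = p} p∈ eq) run) = call t m p p∈ eq (toResidual run)
  toResidual (r-cons (s-ret {t} {m} {σq = q} q∈ eq) run)  = ret t m q q∈ eq (toResidual run)

  toResidual-actions : ∀ {σ τ σ' α} (run : Run σ τ σ' α) → actions (toResidual run) ≡ τ
  toResidual-actions r-nil                    = refl
  toResidual-actions (r-cons (s-cmd _) run)    = cong (_ ∷_) (toResidual-actions run)
  toResidual-actions (r-cons (s-call _ _) run) = cong (_ ∷_) (toResidual-actions run)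
  toResidual-actions (r-cons (s-ret _ _) run)  = cong (_ ∷_) (toResidual-actions run)

  toResidual-pendingActions : ∀ {σ τ σ' α} (run : Run σ τ σ' α) → pendingActions (toResidual run) ≡ τ
  toResidual-pendingActions r-nil                    = refl
  toResidual-pendingActions (r-cons (s-cmd _) run)    = cong (_ ∷_) (toResidual-pendingActions run)
  toResidual-pendingActions (r-cons (s-call _ _) run) = cong (_ ∷_) (toResidual-pendingActions run)
  toResidual-pendingActions (r-cons (s-ret _ _) run)  = cong (_ ∷_) (toResidual-pendingActions run)

  toResidual-pendingHistory : ∀ {σ τ σ' α} (run : Run σ τ σ' α) → pendingHistory (toResidual run) ≡ history α
  toResidual-pendingHistory r-nil                    = refl
  toResidual-pendingHistory (r-cons (s-cmd _) run)    = toResidual-pendingHistory run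
  toResidual-pendingHistory (r-cons (s-call _ _) run) = cong (_ ∷_) (toResidual-pendingHistory run)
  toResidual-pendingHistory (r-cons (s-ret _ _) run)  = cong (_ ∷_) (toResidual-pendingHistory run)

  toResidual-hoistedResources : ∀ {σ τ σ' α} (run : Run σ τ σ' α) → hoistedResources (toResidual run) ≡ []
  toResidual-hoistedResources r-nil                    = refl
  toResidual-hoistedResources (r-cons (s-cmd _) run)    = toResidual-hoistedResources run
  toResidual-hoistedResources (r-cons (s-call _ _) run) = toResidual-hoistedResources run
  toResidual-hoistedResources (r-cons (s-ret _ _) run)  = toResidual-hoistedResources run

  toResidual-unblocked : ∀ {σ τ σ' α} (run : Run σ τ σ' α) Blocked → Unblocked Blocked (toResidual run)
  toResidual-unblocked r-nil                    _ = tt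
  toResidual-unblocked (r-cons (s-cmd _) run)    _ = toResidual-unblocked run _
  toResidual-unblocked (r-cons (s-call _ _) run) _ = toResidual-unblocked run _
  toResidual-unblocked (r-cons (s-ret _ _) run)  _ = toResidual-unblocked run _

  inside⇒no-pendingCall : ∀ {s} (r : Residual s) {τ st Y₁ B t m p} →
    WellFormed st (actions r ++ τ) → st t ≡ true →
    pendingHistory r ≡ Y₁ ++ call t m p ∷ B → All (λ a → IThread a ≢ t) Y₁ → ⊥
  inside⇒no-pendingCall [] {Y₁ = Y₁} _ _ eq _ = []≢++∷ Y₁ eq
  inside⇒no-pendingCall (cmd _ _ _ r) (cmd _ wf) st-t eq Y₁≢t = inside⇒no-pendingCall r wf st-t eq Y₁≢t
  inside⇒no-pendingCall (call _ _ _ _ _ r) {Y₁ = []} (call st-t' _) st-t refl _ with trans (sym st-t) st-t'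
  ... | ()
  inside⇒no-pendingCall (call t' _ _ _ _ r) {st = st} {Y₁ = _ ∷ Y₁} (call _ wf) st-t eq (t'≢t ∷ Y₁≢t)
    with refl ← ∷-injectiveˡ eq =
    inside⇒no-pendingCall r wf (trans (update-other st true t'≢t) st-t) (∷-injectiveʳ eq) Y₁≢t
  inside⇒no-pendingCall (hoisted t' _ _ _ r) {st = st} {t = t} (call st-t' wf) st-t eq Y₁≢t with t' ≟ t
  ... | yes refl with () ← trans (sym st-t) st-t'
  ... | no t'≢t = inside⇒no-pendingCall r wf (trans (update-other st true t'≢t) st-t) eq Y₁≢t
  inside⇒no-pendingCall (ret _ _ _ _ _ r) {Y₁ = []} _ _ () _
  inside⇒no-pendingCall (ret t' _ _ _ _ r) {st = st} {Y₁ = _ ∷ Y₁} (ret _ wf) st-t eq (t'≢t ∷ Y₁≢t)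
    with refl ← ∷-injectiveˡ eq =
    inside⇒no-pendingCall r wf (trans (update-other st false t'≢t) st-t) (∷-injectiveʳ eq) Y₁≢t

  ⨀ : List St → Maybe St
  ⨀ []       = just e
  ⨀ (a ∷ as) = just a ⊙ ⨀ as

  ⨀-insert : ∀ xs y ys → ⨀ (xs ++ y ∷ ys) ≡ just y ⊙ ⨀ (xs ++ ys)
  ⨀-insert []       y ys = refl
  ⨀-insert (x ∷ xs) y ys = trans (cong (just x ⊙_) (⨀-insert xs y ys)) (x⊙yz≡y⊙xz (just x) (just y) (⨀ (xs ++ ys)))

  ⨀-∷ʳ : ∀ xs y → ⨀ (xs ++ y ∷ []) ≡ just y ⊙ ⨀ xs
  ⨀-∷ʳ xs y = trans (⨀-insert xs y []) (cong (λ zs → just y ⊙ ⨀ zs) (++-identityʳ xs))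

  record Hoisting {s} (r : Residual s) (Blocked : Tid → Set) (Y₁ B : History St M) (t : Tid) (m : M) (p : St) : Set where
    field
      r'        : Residual s
      history≡  : pendingHistory r' ≡ Y₁ ++ B
      actions≡  : actions r' ≡ actions r
      size≡     : size r' ≡ size r
      isPre     : pre m t p
      hoisted≡  : ⨀ (hoistedResources r') ≡ just p ⊙ ⨀ (hoistedResources r)
      W₁ W₂     : List Act
      pending≡  : pendingActions r ≡ W₁ ++ callA t m ∷ W₂
      pending'≡ : pendingActions r' ≡ W₁ ++ W₂
      W₁≢t      : All (λ a → thread a ≢ t) W₁
      unblocked : Unblocked Blocked r'

  hoist : ∀ {s} (r : Residual s) {τ st Blocked Y₁ B t m p} → pendingHistory r ≡ Y₁ ++ call t m p ∷ B →
          WellFormed st (actions r ++ τ) → All (λ a → IThread a ≢ t) Y₁ → Unblocked Blocked r → ¬ Blocked t →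
          Hoisting r Blocked Y₁ B t m p
  hoist [] {Y₁ = Y₁} eq _ _ _ _ = ⊥-elim ([]≢++∷ Y₁ eq)
  hoist (cmd t' c σ'∈ r) {st = st} eq (cmd st-t' wf) Y₁≢t ub ¬Bt =
    let open Hoisting (hoist r eq wf Y₁≢t ub ¬Bt) in record
      { r' = cmd t' c σ'∈ r' ; history≡ = history≡ ; actions≡ = cong (cmdA t' c ∷_) actions≡ ; size≡ = cong suc size≡
      ; isPre = isPre ; hoisted≡ = hoisted≡ ; W₁ = cmdA t' c ∷ W₁ ; W₂ = W₂
      ; pending≡ = cong (cmdA t' c ∷_) pending≡ ; pending'≡ = cong (cmdA t' c ∷_) pending'≡
      ; W₁≢t = (λ t'≡t → inside⇒no-pendingCall r wf (subst (λ u → st u ≡ true) t'≡t st-t') eq Y₁≢t) ∷ W₁≢t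
      ; unblocked = unblocked }
  hoist (call t' m' p' p'∈ eq' r) {Y₁ = []} eq (call _ _) _ ub ¬Bt with refl ← ∷-injectiveˡ eq = record
    { r' = hoisted t' m' p' eq' r ; history≡ = ∷-injectiveʳ eq ; actions≡ = refl ; size≡ = refl
    ; isPre = p'∈ ; hoisted≡ = refl ; W₁ = [] ; W₂ = pendingActions r ; pending≡ = refl ; pending'≡ = refl
    ; W₁≢t = [] ; unblocked = ¬Bt , Unblocked-anti r inj₂ ub }
  hoist (call t' m' p' p'∈ eq' r) {Y₁ = _ ∷ Y₁} eq (call _ wf) (t'≢t ∷ Y₁≢t) ub ¬Bt with refl ← ∷-injectiveˡ eq =
    let open Hoisting (hoist r (∷-injectiveʳ eq) wf Y₁≢t ub (Sum.[ t'≢t ∘ sym , ¬Bt ])) in record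
      { r' = call t' m' p' p'∈ eq' r' ; history≡ = cong (call t' m' p' ∷_) history≡
      ; actions≡ = cong (callA t' m' ∷_) actions≡
      ; size≡ = cong suc size≡ ; isPre = isPre ; hoisted≡ = hoisted≡ ; W₁ = callA t' m' ∷ W₁ ; W₂ = W₂
      ; pending≡ = cong (callA t' m' ∷_) pending≡ ; pending'≡ = cong (callA t' m' ∷_) pending'≡
      ; W₁≢t = t'≢t ∷ W₁≢t ; unblocked = unblocked }
  hoist (hoisted t' m' p' eq' r) {p = p} eq (call _ wf) Y₁≢t (¬Bt' , ub) ¬Bt =
    let open Hoisting (hoist r eq wf Y₁≢t ub ¬Bt) in record
      { r' = hoisted t' m' p' eq' r' ; history≡ = history≡ ; actions≡ = cong (callA t' m' ∷_) actions≡
      ; size≡ = cong suc size≡ ; isPre = isPre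
      ; hoisted≡ = trans (cong (just p' ⊙_) hoisted≡) (x⊙yz≡y⊙xz (just p') (just p) (⨀ (hoistedResources r)))
      ; W₁ = W₁ ; W₂ = W₂ ; pending≡ = pending≡ ; pending'≡ = pending'≡ ; W₁≢t = W₁≢t
      ; unblocked = ¬Bt' , unblocked }
  hoist (ret _ _ _ _ _ r) {Y₁ = []} () _ _ _ _
  hoist (ret t' m' q' q'∈ eq' r) {Y₁ = _ ∷ Y₁} eq (ret _ wf) (t'≢t ∷ Y₁≢t) ub ¬Bt with refl ← ∷-injectiveˡ eq =
    let open Hoisting (hoist r (∷-injectiveʳ eq) wf Y₁≢t ub (Sum.[ t'≢t ∘ sym , ¬Bt ])) in record
      { r' = ret t' m' q' q'∈ eq' r' ; history≡ = cong (ret t' m' q' ∷_) history≡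
      ; actions≡ = cong (retA t' m' ∷_) actions≡
      ; size≡ = cong suc size≡ ; isPre = isPre ; hoisted≡ = hoisted≡ ; W₁ = retA t' m' ∷ W₁ ; W₂ = W₂
      ; pending≡ = cong (retA t' m' ∷_) pending≡ ; pending'≡ = cong (retA t' m' ∷_) pending'≡
      ; W₁≢t = t'≢t ∷ W₁≢t ; unblocked = unblocked }

  -- returns performed by the original run but not yet by the rearranged one
  record Deferred : Set where
    constructor deferred
    field
      tid      : Tid
      method   : M
      resource : St
      isPost   : post method tid resource
  open Deferred

  deferredEvent : Deferred → IAct St M
  deferredEvent d = ret (tid d) (method d) (resource d)

  deferredAction : Deferred → Act
  deferredAction d = retA (tid d) (method d)

  DeferredThread : List Deferred → Tid → Set
  DeferredThread D u = Any (λ d → tid d ≡ u) D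

  Idle : Status → List Deferred → Set
  Idle st = All (λ d → st (tid d) ≡ false)

  Idle⇒thread≢ : ∀ {st T} D → Idle st D → st T ≡ true → All (λ a → thread a ≢ T) (map deferredAction D)
  Idle⇒thread≢ {st} D idle st-T = All.map⁺ (All.map (λ st-d d≡T → not-¬ (trans (cong st d≡T) st-T) st-d) idle)

  Idle-update-false : ∀ {st T} D → Idle st D → Idle (update st T false) D
  Idle-update-false {st} {T} D = All.map (λ {d} → idle-update d (T ≟ tid d))
    where
    idle-update : ∀ d → Dec (T ≡ tid d) → st (tid d) ≡ false → update st T false (tid d) ≡ false
    idle-update d (yes refl) _    = update-same st T false
    idle-update d (no T≢d)   st-d = trans (update-other st false T≢d) st-d

  Idle-update-other : ∀ {st T} b D → ¬ DeferredThread D T → Idle st D → Idle (update st T b) D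
  Idle-update-other b []      _   []            = []
  Idle-update-other {st} b (d ∷ D) ¬DT (st-d ∷ idle) =
    trans (update-other st b (¬DT ∘ here ∘ sym)) st-d ∷ Idle-update-other b D (¬DT ∘ there) idle

  ⨀-map-insert : ∀ D₁ d D₂ → ⨀ (map resource (D₁ ++ d ∷ D₂)) ≡ just (resource d) ⊙ ⨀ (map resource (D₁ ++ D₂))
  ⨀-map-insert D₁ d D₂ = begin
    ⨀ (map resource (D₁ ++ d ∷ D₂))
      ≡⟨ cong ⨀ (map-++ resource D₁ (d ∷ D₂)) ⟩
    ⨀ (map resource D₁ ++ resource d ∷ map resource D₂)
      ≡⟨ ⨀-insert (map resource D₁) (resource d) (map resource D₂) ⟩
    just (resource d) ⊙ ⨀ (map resource D₁ ++ map resource D₂)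
      ≡⟨ cong (λ xs → just (resource d) ⊙ ⨀ xs) (map-++ resource D₁ D₂) ⟨
    just (resource d) ⊙ ⨀ (map resource (D₁ ++ D₂))
      ∎

  map-++-assoc : ∀ {X Y : Set} (g : X → Y) (xs ys : List X) zs → map g (xs ++ ys) ++ zs ≡ map g xs ++ map g ys ++ zs
  map-++-assoc g xs ys zs = trans (cong (_++ zs) (map-++ g xs ys)) (++-assoc (map g xs) (map g ys) zs)

  unconstrained⇒thread≢ : ∀ {x : IAct St M} {A} →
                          All (λ a → ¬ OrderConstraint x a) A → All (λ a → IThread a ≢ IThread x) A
  unconstrained⇒thread≢ = All.map (λ ¬c a≡x → ¬c (inj₁ (sym a≡x)))

  fuel-pred : ∀ a {b n} → a + suc b ≤ suc n → a + b ≤ n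
  fuel-pred a {b} {n} = ≤-pred ∘ subst (_≤ suc n) (+-suc a b)

  ∈O-frame⊙ : ∀ {t c s s' N} X → s' ∈O f t c s → just N ≡ just s ⊙ X →
              ∃ λ N' → N' ∈O f t c N × just N' ≡ just s' ⊙ X
  ∈O-frame⊙ X s'∈ N≡ with ⊙-factorʳ _ X (sym N≡)
  ... | F , X≡F , sF≡N with ∈O-frame s'∈ sF≡N
  ... | N' , s'F≡N' , N'∈ = N' , N'∈ , trans (sym s'F≡N') (cong (just _ ⊙_) (sym X≡F))

  -- τ₀ is the original trace followed by the rest τ' of a trace of the library
  -- that it is a prefix of.
  module Simulation (τ' τ₀ : List Act) where
    Result : St → History St M → List Act → Set
    Result N H emitted = ∃₂ λ τ N' → ∃ λ α → Run N τ N' α × history α ≡ H ×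
                         ∃ λ τ'' → Swaps τ₀ (emitted ++ τ ++ τ'')

    record Inv (n : ℕ) (H : History St M) {s} (r : Residual s) (D : List Deferred) (N : St) (st : Status)
               (emitted : List Act) : Set where
      field
        fuel       : length H + size r ≤ n
        frame      : just N ≡ just s ⊙ (⨀ (map resource D) ⊙ ⨀ (hoistedResources r))
        extraction : Extraction H (map deferredEvent D ++ pendingHistory r)
        admits     : Admits N H
        wellFormed : WellFormed st (actions r ++ τ')
        unblocked  : Unblocked (DeferredThread D) r
        idle       : Idle st D
        swaps      : Swaps τ₀ (emitted ++ map deferredAction D ++ pendingActions r ++ τ')

    Rec : ℕ → Set
    Rec n = ∀ {H s} {r : Residual s} {D N st emitted} → Inv n H r D N st emitted → Result N H emitted

    emit : ∀ {N N' a b H emitted} → Step N a N' b → Result N' H (emitted ++ a ∷ []) →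
           Result N (history (b ∷ []) ++ H) emitted
    emit {a = a} {b} {H} {emitted} step (τ , N'' , α , run , α≡H , τ'' , ss) =
      a ∷ τ , N'' , b ∷ α , r-cons step run , history-∷ b , τ'' , Swaps-≡ (++-assoc emitted (a ∷ []) (τ ++ τ'')) ss
      where
      history-∷ : ∀ b → history (b ∷ α) ≡ history (b ∷ []) ++ H
      history-∷ (iact x)   = cong (x ∷_) α≡H
      history-∷ (cmdI _ _) = α≡H

    step-cmd : ∀ {n H s s' t c D N st emitted} {s'∈ : s' ∈O f t c s} {r : Residual s'} → Rec n →
               Inv (suc n) H (cmd t c s'∈ r) D N st emitted → Result N H emitted
    step-cmd {H = H} {t = t} {c} {D} {emitted = emitted} {s'∈} {r} rec I with Inv.wellFormed I
    ... | cmd st-t wf with ∈O-frame⊙ (⨀ (map resource D) ⊙ ⨀ (hoistedResources r)) s'∈ (Inv.frame I)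
    ... | N' , N'∈ , frame' = emit {emitted = emitted} (s-cmd N'∈) (rec {emitted = emitted ++ cmdA t c ∷ []} record
      { fuel = fuel-pred (length H) fuel ; frame = frame' ; extraction = extraction
      ; admits = Admits-resp-≈ (∈O⇒≈ N'∈) admits ; wellFormed = wf ; unblocked = unblocked ; idle = idle
      ; swaps = Swaps-emit emitted (map deferredAction D) (pendingActions r ++ τ') (Idle⇒thread≢ D idle st-t) swaps })
      where open Inv I

    step-hoisted : ∀ {n H s s' t m p D N st emitted} {sp≡s' : s ⊛ p ≡ just s'} {r : Residual s'} → Rec n →
                   Inv (suc n) H (hoisted t m p sp≡s' r) D N st emitted → Result N H emitted
    step-hoisted {H = H} {s} {s'} {p = p} {D} {N} {emitted = emitted} {sp≡s'} {r} rec I with Inv.wellFormed I | Inv.unblocked I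
    ... | call _ wf | ¬DT , ub = rec {emitted = emitted} record
      { fuel = fuel-pred (length H) fuel ; frame = frame' ; extraction = extraction ; admits = admits
      ; wellFormed = wf ; unblocked = ub ; idle = Idle-update-other true D ¬DT idle ; swaps = swaps }
      where
      open Inv I
      Dp = ⨀ (map resource D)
      Fr = ⨀ (hoistedResources r)
      frame' : just N ≡ just s' ⊙ (Dp ⊙ Fr)
      frame' = begin
        just N                          ≡⟨ frame ⟩
        just s ⊙ (Dp ⊙ (just p ⊙ Fr))   ≡⟨ cong (just s ⊙_) (x⊙yz≡y⊙xz Dp (just p) Fr) ⟩
        just s ⊙ (just p ⊙ (Dp ⊙ Fr))   ≡⟨ ⊙-assoc (just s) (just p) (Dp ⊙ Fr) ⟨
        just s ⊙ just p ⊙ (Dp ⊙ Fr)     ≡⟨ cong (_⊙ (Dp ⊙ Fr)) sp≡s' ⟩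
        just s' ⊙ (Dp ⊙ Fr)             ∎

    emit-deferred : ∀ {n H s} {r : Residual s} {D₁ d D₂ N st emitted} → Rec n →
      Inv (suc n) (deferredEvent d ∷ H) r (D₁ ++ d ∷ D₂) N st emitted →
      All (λ a → IThread a ≢ tid d) (map deferredEvent D₁) →
      Extraction H (map deferredEvent D₁ ++ map deferredEvent D₂ ++ pendingHistory r) →
      Result N (deferredEvent d ∷ H) emitted
    emit-deferred {H = H} {s} {r} {D₁} {d} {D₂} {N} {emitted = emitted} rec I D₁≢d extraction'
      with ⊙-factorʳ (resource d) (just s ⊙ (Dp' ⊙ Fr)) (sym N≡)
      where
      q = just (resource d)
      Dp' = ⨀ (map resource (D₁ ++ D₂))
      Fr = ⨀ (hoistedResources r)
      N≡ : just N ≡ q ⊙ (just s ⊙ (Dp' ⊙ Fr))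
      N≡ = begin
        just N
          ≡⟨ Inv.frame I ⟩
        just s ⊙ (⨀ (map resource (D₁ ++ d ∷ D₂)) ⊙ Fr)
          ≡⟨ cong (λ X → just s ⊙ (X ⊙ Fr)) (⨀-map-insert D₁ d D₂) ⟩
        just s ⊙ (q ⊙ Dp' ⊙ Fr)
          ≡⟨ solve 4 (λ s q D F → s ⊕ ((q ⊕ D) ⊕ F) ⊜ q ⊕ (s ⊕ (D ⊕ F))) refl (just s) q Dp' Fr ⟩
        q ⊙ (just s ⊙ (Dp' ⊙ Fr))
          ∎
    ... | N' , N'≡ , qN'≡N =
      emit {emitted = emitted} (s-ret (isPost d) qN'≡N) (rec {emitted = emitted ++ deferredAction d ∷ []} record
        { fuel = ≤-pred fuel ; frame = sym N'≡
        ; extraction = subst (Extraction H) (sym (map-++-assoc deferredEvent D₁ D₂ (pendingHistory r))) extraction'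
        ; admits = Admits-ret {t = tid d} {method d} admits qN'≡N
        ; wellFormed = wellFormed ; unblocked = Unblocked-anti r (Any-insertMiddle D₁) unblocked
        ; idle = All-removeMiddle D₁ idle
        ; swaps = Swaps-≡ (cong ((emitted ++ deferredAction d ∷ []) ++_) (sym (map-++-assoc deferredAction D₁ D₂ R)))
                    (Swaps-emit emitted (map deferredAction D₁) {deferredAction d} (map deferredAction D₂ ++ R) (All.map⁺ (All.map⁻ D₁≢d))
                      (Swaps-≡ (cong (emitted ++_) (map-++-assoc deferredAction D₁ (d ∷ D₂) R)) swaps)) })
      where
      open Inv I
      R = pendingActions r ++ τ'

    hoist-call : ∀ {n H s} {r : Residual s} {D Y₁ B t m p N st emitted} → Rec n →
      Inv (suc n) (call t m p ∷ H) r D N st emitted →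
      Hoisting r (DeferredThread D) Y₁ B t m p →
      All (λ a → thread a ≢ t) (map deferredAction D) →
      Extraction H ((map deferredEvent D ++ Y₁) ++ B) →
      Result N (call t m p ∷ H) emitted
    hoist-call {H = H} {s} {r} {D} {Y₁} {B} {t} {m} {p} {N} {st} {emitted} rec I h D≢t extraction' =
      let (N' , Np≡N' , admits') = Admits-call {t = t} {m} (Inv.admits I) in
      emit {emitted = emitted} (s-call isPre Np≡N') (rec {emitted = emitted ++ callA t m ∷ []} record
        { fuel = subst (λ k → length H + k ≤ _) (sym size≡) (≤-pred fuel) ; frame = frame' Np≡N'
        ; extraction = subst (Extraction H) (trans (++-assoc (map deferredEvent D) Y₁ B)
                                                   (cong (map deferredEvent D ++_) (sym history≡))) extraction'
        ; admits = admits'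
        ; wellFormed = subst (λ τ → WellFormed st (τ ++ τ')) (sym actions≡) wellFormed
        ; unblocked = Hoisting.unblocked h ; idle = idle
        ; swaps = Swaps-≡ (cong ((emitted ++ callA t m ∷ []) ++_) (sym (trans (cong (λ τ → A ++ τ ++ τ') pending'≡) (reassoc A W₁ W₂ τ'))))
                    (Swaps-emit emitted (A ++ W₁) {callA t m} (W₂ ++ τ') (All.++⁺ D≢t W₁≢t)
                      (Swaps-≡ (cong (emitted ++_) (trans (cong (λ τ → A ++ τ ++ τ') pending≡) (reassoc A W₁ (callA t m ∷ W₂) τ')))
                        swaps)) })
      where
      open Inv I
      open Hoisting h hiding (unblocked)
      A = map deferredAction D
      Dp = ⨀ (map resource D)
      Fr = ⨀ (hoistedResources r)
      reassoc : ∀ (A W₁ W₂ τ : List Act) → A ++ (W₁ ++ W₂) ++ τ ≡ (A ++ W₁) ++ W₂ ++ τ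
      reassoc A W₁ W₂ τ = trans (cong (A ++_) (++-assoc W₁ W₂ τ)) (sym (++-assoc A W₁ (W₂ ++ τ)))
      frame' : ∀ {N'} → N ⊛ p ≡ just N' → just N' ≡ just s ⊙ (Dp ⊙ ⨀ (hoistedResources r'))
      frame' {N'} Np≡N' = begin
        just N'                              ≡⟨ Np≡N' ⟨
        just N ⊙ just p                      ≡⟨ cong (_⊙ just p) frame ⟩
        just s ⊙ (Dp ⊙ Fr) ⊙ just p
          ≡⟨ solve 4 (λ s D F p → (s ⊕ (D ⊕ F)) ⊕ p ⊜ s ⊕ (D ⊕ (p ⊕ F))) refl (just s) Dp Fr (just p) ⟩
        just s ⊙ (Dp ⊙ (just p ⊙ Fr))        ≡⟨ cong (λ X → just s ⊙ (Dp ⊙ X)) hoisted≡ ⟨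
        just s ⊙ (Dp ⊙ ⨀ (hoistedResources r')) ∎

    emit-return : ∀ {n H s s' t m q} {q∈ : post m t q} {qs'≡s : q ⊛ s' ≡ just s} {r : Residual s'} {D N st emitted} →
      Rec n → Inv (suc n) (ret t m q ∷ H) (ret t m q q∈ qs'≡s r) D N st emitted →
      Extraction H (map deferredEvent D ++ pendingHistory r) → Result N (ret t m q ∷ H) emitted
    emit-return {H = H} {s} {s'} {t} {m} {q} {q∈} {qs'≡s} {r} {D} {N} {emitted = emitted} rec I extraction'
      with Inv.wellFormed I
    ... | ret st-t wf =
      let (N' , N'≡ , qN'≡N) = ⊙-factorʳ q (just s' ⊙ Rest) (sym N≡) in
      emit {emitted = emitted} (s-ret q∈ qN'≡N) (rec {emitted = emitted ++ retA t m ∷ []} record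
        { fuel = fuel-pred (length H) (m≤n⇒m≤1+n (≤-pred fuel)) ; frame = sym N'≡ ; extraction = extraction'
        ; admits = Admits-ret {t = t} {m} admits qN'≡N ; wellFormed = wf
        ; unblocked = Unblocked-anti r inj₂ unblocked ; idle = Idle-update-false {T = t} D idle
        ; swaps = Swaps-emit emitted (map deferredAction D) {retA t m} (pendingActions r ++ τ')
                    (Idle⇒thread≢ D idle st-t) swaps })
      where
      open Inv I
      Rest = ⨀ (map resource D) ⊙ ⨀ (hoistedResources r)
      N≡ : just N ≡ just q ⊙ (just s' ⊙ Rest)
      N≡ = trans frame (trans (cong (_⊙ Rest) (sym qs'≡s)) (⊙-assoc (just q) (just s') Rest))

    defer : ∀ {n x H s s' t m q} {q∈ : post m t q} {qs'≡s : q ⊛ s' ≡ just s} {r : Residual s'} {D N st emitted} →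
      Rec n → Inv (suc n) (x ∷ H) (ret t m q q∈ qs'≡s r) D N st emitted → Result N (x ∷ H) emitted
    defer {x = x} {H} {s} {s'} {t} {m} {q} {q∈} {qs'≡s} {r} {D} {N} {st} {emitted} rec I with Inv.wellFormed I
    ... | ret _ wf = rec {emitted = emitted} record
      { fuel = fuel-pred (length (x ∷ H)) fuel ; frame = frame'
      ; extraction = subst (Extraction (x ∷ H)) (sym (map-++-assoc deferredEvent D (d ∷ []) (pendingHistory r))) extraction
      ; admits = admits ; wellFormed = wf
      ; unblocked = Unblocked-anti r (Sum.[ inj₂ , inj₁ ∘ sym ∘ Any.singleton⁻ ] ∘ Any.++⁻ D) unblocked
      ; idle = All.∷ʳ⁺ (Idle-update-false {T = t} D idle) (update-same st t false)
      ; swaps = Swaps-≡ (cong (emitted ++_) (sym (map-++-assoc deferredAction D (d ∷ []) (pendingActions r ++ τ')))) swaps }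
      where
      open Inv I
      d = deferred t m q q∈
      Dp = ⨀ (map resource D)
      Fr = ⨀ (hoistedResources r)
      frame' : just N ≡ just s' ⊙ (⨀ (map resource (D ++ d ∷ [])) ⊙ Fr)
      frame' = begin
        just N                        ≡⟨ frame ⟩
        just s ⊙ (Dp ⊙ Fr)            ≡⟨ cong (_⊙ (Dp ⊙ Fr)) qs'≡s ⟨
        just q ⊙ just s' ⊙ (Dp ⊙ Fr)
          ≡⟨ solve 4 (λ q s D F → (q ⊕ s) ⊕ (D ⊕ F) ⊜ s ⊕ ((q ⊕ D) ⊕ F)) refl (just q) (just s') Dp Fr ⟩
        just s' ⊙ (just q ⊙ Dp ⊙ Fr)
          ≡⟨ cong (λ X → just s' ⊙ (X ⊙ Fr)) (trans (cong ⨀ (map-++ resource D (d ∷ []))) (⨀-∷ʳ (map resource D) q)) ⟨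
        just s' ⊙ (⨀ (map resource (D ++ d ∷ [])) ⊙ Fr) ∎

    -- H continues with a return that the residual still has to reach
    advance : ∀ {n H s} (r : Residual s) {D Y₁ B t m q N st emitted} → Rec n →
      Inv (suc n) (ret t m q ∷ H) r D N st emitted →
      pendingHistory r ≡ Y₁ ++ ret t m q ∷ B →
      All (λ a → ¬ OrderConstraint (ret t m q) a) (map deferredEvent D ++ Y₁) →
      Extraction H ((map deferredEvent D ++ Y₁) ++ B) →
      Result N (ret t m q ∷ H) emitted
    advance []                  {Y₁ = Y₁} _ _ eq _ _ = ⊥-elim ([]≢++∷ Y₁ eq)
    advance (cmd _ _ _ _)       rec I _ _ _ = step-cmd rec I
    advance (hoisted _ _ _ _ _) rec I _ _ _ = step-hoisted rec I
    advance (call _ _ _ _ _ _)  {Y₁ = []} _ _ () _ _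
    advance (call t' m' p' _ _ _) {D} {Y₁ = _ ∷ _} {t = t} {m} {q} _ _ eq unconstrained _
      with refl ← ∷-injectiveˡ eq =
      ⊥-elim (All.head (All.++⁻ʳ (map deferredEvent D) unconstrained) (inj₂ ((t , m , q , refl) , (t' , m' , p' , refl))))
    advance (ret _ _ _ _ _ _)   {D} {Y₁ = []} rec I eq _ extraction' with refl ← ∷-injectiveˡ eq =
      emit-return rec I (subst (Extraction _) (cong₂ _++_ (++-identityʳ (map deferredEvent D)) (sym (∷-injectiveʳ eq)))
                                extraction')
    advance (ret _ _ _ _ _ _)   {Y₁ = _ ∷ _} rec I _ _ _ = defer rec I

    dispatch : ∀ {n x H s} {r : Residual s} {D N st emitted} → Rec n →
      Inv (suc n) (x ∷ H) r D N st emitted → Result N (x ∷ H) emitted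
    dispatch {r = r} {D} rec I with Inv.extraction I
    ... | extract A B eq unconstrained extraction' with ++-≡-++∷ (map deferredEvent D) (pendingHistory r) A B eq
    ... | inj₁ (X₂ , D≡ , refl) with map-≡-++∷ deferredEvent D A X₂ D≡
    ...   | D₁ , d , D₂ , refl , refl , refl , refl = emit-deferred rec I (unconstrained⇒thread≢ unconstrained) extraction'
    dispatch {x = call t m p} {r = r} {D} rec I | extract _ _ _ unconstrained extraction' | inj₂ (Y₁ , Y≡ , refl) =
      hoist-call rec I
        (hoist r Y≡ (Inv.wellFormed I) (All.++⁻ʳ (map deferredEvent D) A≢t) (Inv.unblocked I)
               (All.All¬⇒¬Any (All.map⁻ D≢t)))
        (All.map⁺ (All.map⁻ D≢t)) extraction'
      where
      A≢t : All (λ a → IThread a ≢ t) (map deferredEvent D ++ Y₁)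
      A≢t = unconstrained⇒thread≢ unconstrained
      D≢t : All (λ a → IThread a ≢ t) (map deferredEvent D)
      D≢t = All.++⁻ˡ (map deferredEvent D) A≢t
    dispatch {x = ret t m q} {r = r} rec I | extract _ _ _ unconstrained extraction' | inj₂ (Y₁ , Y≡ , refl) =
      advance r rec I Y≡ unconstrained extraction'

    simulate : ∀ n → Rec n
    simulate n       {[]}    {r = r} {D} I = [] , _ , [] , r-nil , refl , map deferredAction D ++ pendingActions r ++ τ' , Inv.swaps I
    simulate zero    {_ ∷ _} I with () ← Inv.fuel I
    simulate (suc n) {_ ∷ _} I = dispatch (simulate n) I

  rearrange : ∀ {σ₀ τ σ' α H} τ' → Run σ₀ τ σ' α → WellFormed (λ _ → false) (τ ++ τ') →
              Admits σ₀ H → H ⊑H history α →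
              ∃₂ λ τ₁ N → ∃ λ α₁ → Run σ₀ τ₁ N α₁ × history α₁ ≡ H ×
                ∃ λ τ'' → Swaps (τ ++ τ') (τ₁ ++ τ'')
  rearrange {σ₀} {τ} {H = H} τ' run wf admits H⊑ = simulate (length H + size r) {emitted = []} record
    { fuel = ≤-refl
    ; frame = sym (trans (cong (λ X → just σ₀ ⊙ (just e ⊙ ⨀ X)) (toResidual-hoistedResources run))
                         (solve 1 (λ x → x ⊕ (ε⊕ ⊕ ε⊕) ⊜ x) refl (just σ₀)))
    ; extraction = IndexEmbedding⇒Extraction (⊑H⇒IndexEmbedding (subst (H ⊑H_) (sym (toResidual-pendingHistory run)) H⊑))
    ; admits = admits
    ; wellFormed = subst (λ τ₀ → WellFormed _ (τ₀ ++ τ')) (sym (toResidual-actions run)) wf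
    ; unblocked = toResidual-unblocked run _
    ; idle = []
    ; swaps = Swaps-≡ (cong (_++ τ') (sym (toResidual-pendingActions run))) ε
    }
    where
    open Simulation τ' (τ ++ τ')
    r = toResidual run

  interf⇒Balanced : ∀ {L I l H} → interf L I l H → Balanced l H
  interf⇒Balanced (_ , _ , l≈σ₀ , _ , _ , _ , _ , run , refl) = Balanced-resp-≈ _ l≈σ₀ (Run⇒Balanced run)

  interf-⊑-closed : ∀ {L I l l' H H'} → Balanced l H → interf L I l' H' → l' ≼ l → H ⊑H H' → interf L I l' H
  interf-⊑-closed {L} {l = l} bal (σ₀ , σ₀∈I , l'≈σ₀ , τ , (k , k≥1 , τ' , at) , _ , _ , run , refl) l'≼l H⊑H'
    with rearrange τ' run (AllThreads-wellFormed L k at) (l , ≼-respˡ-≈ (≈-sym l'≈σ₀) l'≼l , bal) H⊑H'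
  ... | τ₁ , N , α₁ , run₁ , α₁≡H , τ'' , ss =
    σ₀ , σ₀∈I , l'≈σ₀ , τ₁ , (k , k≥1 , τ'' , AllThreads-swaps L k at ss) , N , α₁ , run₁ , α₁≡H

⊑H-refl : ∀ {S M : Set} (H : History S M) → H ⊑H H
⊑H-refl H = ⤖-id _ , (λ _ → refl) , (λ _ _ i<j _ → i<j)

corollary6p6 : (SA : SepAlg) → FootprintCancellative SA → (P : Prims SA) →
    {M : Set} (Γ : Spec SA M) (L₁ L₂ : Library (Prims.Cmd P) M)
    (I₁ I₂ : SepAlg.St SA → Set) →
    Sem.Safe SA P Γ L₁ I₁ → Sem.Safe SA P Γ L₂ I₂ →
    (Sem.LibLe SA P Γ L₁ I₁ L₂ I₂ ⇔
      (∀ l H → Sem.interf SA P Γ L₁ I₁ l H →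
        ∃ λ l' → _⪯_ SA l' l × Sem.interf SA P Γ L₂ I₂ l' H))
corollary6p6 SA fc P Γ L₁ L₂ I₁ I₂ _ _ = mk⇔ drop-reordering add-reordering
  where
  open Rearrangement SA fc P Γ
  open Sem SA P Γ using (LibLe; interf)
  SameHistory : Set
  SameHistory = ∀ l H → interf L₁ I₁ l H → ∃ λ l' → _⪯_ SA l' l × interf L₂ I₂ l' H

  drop-reordering : LibLe L₁ I₁ L₂ I₂ → SameHistory
  drop-reordering ⊑ l H i₁ with ⊑ l H i₁
  ... | l' , H' , i₂ , l'≼l , H⊑H' = l' , l'≼l , interf-⊑-closed (interf⇒Balanced i₁) i₂ l'≼l H⊑H'

  add-reordering : SameHistory → LibLe L₁ I₁ L₂ I₂
  add-reordering same l H i₁ with same l H i₁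
  ... | l' , l'≼l , i₂ = l' , H , i₂ , l'≼l , ⊑H-refl H
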